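{- For every integer $g\ge 2$ the following hold: (i) $(\mathrm{TT}(g),J)$ is isomorphic to a subgraph of ${\rm SPC}(g-1)$, i.e., there is an injective map $\phi:V(\mathrm{TT}(g))\to\mathbb{Z}_2^{g-1}$ sending each positive edge of $(\mathrm{TT}(g),J)$ to a pair of vectors differing in exactly one coordinate and each negative edge to a pair differing in all coordinates; (ii) $(\mathrm{TT}(g),J)$ is vertex-transitive; (iii) any two vertices of $(\mathrm{TT}(g),J)$ lie on a common negative cycle of length $g$; (iv) $(\mathrm{TT}(g),J)$ is $g$-wide.
   Context: Let $a=\lfloor g/2\rfloor$, $b=\lceil g/2\rceil$. $\mathrm{T}(g)$ has vertex set $\{0,\dots,2a-1\}\times\{0,\dots,b-1\}$, with edges $\{(i,j),(i,j+1)\}$ and $\{(i,j),(i',j)\}$ whenever $i-i'\equiv\pm1\pmod{2a}$ (the cylinder $C_{2a}\square P_b$). $\mathrm{TT}(g)$ is obtained from $\mathrm{T}(g)$ by adding the edges $\{(i,0),(i+a\bmod 2a,\,b-1)\}$ joining antipodal vertices (pairs at distance $a+b-1$ in $\mathrm{T}(g)$); the set of added edges is $J$ (parallel to an existing edge when $g=2$). In the signed graph $(\mathrm{TT}(g),J)$ the edges of $J$ are negative and all others positive. ${\rm SPC}(k)$ is the signed (multi)graph on vertex set $\mathbb{Z}_2^k$ where two vertices are joined by a positive edge if they differ in exactly one coordinate and by a negative edge if they differ in all coordinates. Switching at a vertex set $X$ multiplies by $-$ the signs of the edges in the cut $(X,V\setminus X)$. A signed graph is vertex-transitive if for any two vertices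 $u,v$ there is an automorphism $\varphi$ of the underlying graph with $\varphi(u)=v$ such that the image of the signature under $\varphi$ is switching equivalent to the signature. The sign of a closed walk/cycle is the product of its edge signs. A closed walk has type $ij\in\mathbb{Z}_2^2$ ($i=0$ positive, $i=1$ negative; $j$ the parity of the length); $g_{ij}$ is the minimum length of a closed walk of type $ij$ ($\infty$ if none). $C_{ -g}$ is a cycle of length $g$ with an odd number of negative edges; a signed graph is $g$-wide if $g_{ij}$ of it is at least $g_{ij}(C_{ -g})$ for all $ij$. -}

module Defs where

open import Data.Nat using (ℕ; zero; suc; _*_; _≤_; _<?_; _≤ᵇ_; _<ᵇ_; _≡ᵇ_; ⌊_/2⌋; ⌈_/2⌉; _%_)
open import Data.Fin using (Fin; zero; suc; toℕ; fromℕ<)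
open import Data.Bool using (Bool; true; false; T; _∨_; _xor_)
open import Data.Product using (Σ; _×_; _,_)
open import Data.Sum using (_⊎_)
open import Data.Vec using (Vec; lookup)
open import Data.List using (List; []; _∷_)
open import Data.List.Membership.Propositional using (_∈_)
open import Data.List.Relation.Unary.Unique.Propositional using (Unique)
open import Relation.Binary.PropositionalEquality using (_≡_; _≢_)
open import Relation.Nullary using (yes; no)
open import Function.Bundles using (_↔_; Inverse)

-- Signed multigraphs (no assumption of simplicity: parallel edges allowed)
-- neg e = true  means e is a negative edge.

record SGraph : Set₁ where
  field
    V    : Set
    E    : Set
    end₁ : E → V
    end₂ : E → V
    neg  : E → Bool

Joins : (G : SGraph) → SGraph.E G → SGraph.V G → SGraph.V G → Set
Joins G e u v = (end₁ e ≡ u × end₂ e ≡ v) ⊎ (end₁ e ≡ v × end₂ e ≡ u)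
  where open SGraph G

data Walk (G : SGraph) : SGraph.V G → SGraph.V G → Set where
  []   : ∀ {v} → Walk G v v
  step : ∀ {u v w} (e : SGraph.E G) → Joins G e u v → Walk G v w → Walk G u w

module _ {G : SGraph} where
  open SGraph G

  len : ∀ {u w} → Walk G u w → ℕ
  len []             = 0
  len (step _ _ W)   = suc (len W)

  sgn : ∀ {u w} → Walk G u w → Bool
  sgn []             = false
  sgn (step e _ W)   = neg e xor sgn W

  -- vertices at which each step starts (for a closed walk: every vertex once per visit)
  verts : ∀ {u w} → Walk G u w → List V
  verts []                 = []
  verts (step {u = u} _ _ W) = u ∷ verts W

  edgesOf : ∀ {u w} → Walk G u w → List E
  edgesOf []             = []
  edgesOf (step e _ W)   = e ∷ edgesOf W

IsCycle : (G : SGraph) {v : SGraph.V G} → Walk G v v → Set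
IsCycle G W = 1 ≤ len W × Unique (verts W) × Unique (edgesOf W)

NegCyclesThroughPairs : ℕ → SGraph → Set
NegCyclesThroughPairs g G = ∀ (u v : SGraph.V G) →
  Σ (SGraph.V G) λ x → Σ (Walk G x x) λ W →
    IsCycle G W × len W ≡ g × sgn W ≡ true × u ∈ verts W × v ∈ verts W

csuc : ∀ {n} → Fin n → Fin n
csuc {suc n} i with suc (toℕ i) <? suc n
... | yes p = fromℕ< p
... | no _  = zero

iter : ∀ {A : Set} → ℕ → (A → A) → A → A
iter zero    f x = x
iter (suc k) f x = f (iter k f x)

addMod : ∀ {n} → ℕ → Fin n → Fin n
addMod k = iter k csuc

-- C_{-g}: cycle on Fin g, edge k joins k and k+1 mod g; edge 0 negative.
-- (for g = 2 this is a digon with two parallel edges)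

Cneg : ℕ → SGraph
Cneg g = record
  { V = Fin g ; E = Fin g ; end₁ = λ k → k ; end₂ = csuc
  ; neg = λ k → toℕ k ≡ᵇ 0 }

aT bT : ℕ → ℕ
aT g = ⌊ g /2⌋
bT g = ⌈ g /2⌉

VTT : ℕ → Set
VTT g = Fin (2 * aT g) × Fin (bT g)

data ETT (g : ℕ) : Set where
  vert  : (i : Fin (2 * aT g)) (j j' : Fin (bT g)) → T (suc (toℕ j) ≡ᵇ toℕ j') → ETT g
  -- {(i,j),(i+1 mod 2a, j)}; when 2a = 2 the cycle C_2 has a single edge
  horiz : (i : Fin (2 * aT g)) (j : Fin (bT g)) → T ((2 ≤ᵇ aT g) ∨ (toℕ i ≡ᵇ 0)) → ETT g
  -- J: {(i,0),(i+a mod 2a, b-1)}; when b = 1 the pairs for i and i+a coincide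
  jump  : (i : Fin (2 * aT g)) (z w : Fin (bT g)) → T (toℕ z ≡ᵇ 0) → T (suc (toℕ w) ≡ᵇ bT g)
          → T ((2 ≤ᵇ bT g) ∨ (toℕ i <ᵇ aT g)) → ETT g

e₁TT e₂TT : ∀ {g} → ETT g → VTT g
e₁TT (vert i j j' _)        = i , j
e₁TT (horiz i j _)          = i , j
e₁TT (jump i z w _ _ _)     = i , z
e₂TT (vert i j j' _)        = i , j'
e₂TT (horiz i j _)          = csuc i , j
e₂TT {g} (jump i z w _ _ _) = addMod (aT g) i , w

negTT : ∀ {g} → ETT g → Bool
negTT (vert _ _ _ _)       = false
negTT (horiz _ _ _)        = false
negTT (jump _ _ _ _ _ _)   = true

TTJ : ℕ → SGraph
TTJ g = record { V = VTT g ; E = ETT g ; end₁ = e₁TT ; end₂ = e₂TT ; neg = negTT }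

DifferInExactlyOne : ∀ {k} → Vec Bool k → Vec Bool k → Set
DifferInExactlyOne {k} x y = Σ (Fin k) λ c →
  lookup x c ≢ lookup y c × (∀ c' → c' ≢ c → lookup x c' ≡ lookup y c')

DifferInAll : ∀ {k} → Vec Bool k → Vec Bool k → Set
DifferInAll {k} x y = ∀ (c : Fin k) → lookup x c ≢ lookup y c

SubgraphOfSPC : SGraph → ℕ → Set
SubgraphOfSPC G k = Σ (V → Vec Bool k) λ φ →
    (∀ u v → φ u ≡ φ v → u ≡ v)
  × (∀ e → neg e ≡ false → DifferInExactlyOne (φ (end₁ e)) (φ (end₂ e)))
  × (∀ e → neg e ≡ true  → DifferInAll (φ (end₁ e)) (φ (end₂ e)))
  where open SGraph G

IsAut : (G : SGraph) → (SGraph.V G ↔ SGraph.V G) → (SGraph.E G ↔ SGraph.E G) → Set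
IsAut G φ ψ = ∀ e → Joins G (Inverse.to ψ e) (Inverse.to φ (end₁ e)) (Inverse.to φ (end₂ e))
  where open SGraph G

-- the image signature (σ' (ψ e) = σ e) is switching equivalent to σ:
-- some X ⊆ V with σ' f = σ f xor [f ∈ cut(X, V∖X)] for all f
ImageSwitchingEquiv : (G : SGraph) → (SGraph.E G ↔ SGraph.E G) → Set
ImageSwitchingEquiv G ψ = Σ (V → Bool) λ X → ∀ e →
  neg e ≡ (neg (Inverse.to ψ e) xor (X (end₁ (Inverse.to ψ e)) xor X (end₂ (Inverse.to ψ e))))
  where open SGraph G

VertexTransitive : SGraph → Set
VertexTransitive G = ∀ (u v : V) → Σ (V ↔ V) λ φ → Σ (E ↔ E) λ ψ →
  Inverse.to φ u ≡ v × IsAut G φ ψ × ImageSwitchingEquiv G ψ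
  where open SGraph G

-- (iv) g-wide: g_ij(G) ≥ g_ij(C_{-g}) for every type ij, unfolded as:
-- for every closed walk W of G there is a closed walk of C_{-g} of the
-- same type (sign, parity of length) and length ≤ len W
-- (this is exactly min ≥ min with min ∅ = ∞).

Wide : ℕ → SGraph → Set
Wide g G = ∀ (v : SGraph.V G) (W : Walk G v v) →
  Σ (Fin g) λ x → Σ (Walk (Cneg g) x x) λ W' →
    sgn W' ≡ sgn W × len W' % 2 ≡ len W % 2 × len W' ≤ len W

-- The vertex (i , j) of TT(g) is sent to the vector of ℤ₂^(g−1) whose first a coordinates record,
-- for each c < a, whether the column i lies in the half-turn c+1 … c+a of the column cycle, and
-- whose last b−1 coordinates write the row j in thermometer code. A step along a row or a column
-- flips exactly one coordinate and an edge of J, joining antipodal vertices, flips all of them.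
-- In any signed subgraph of SPC(k) a positive edge changes the parity of the Hamming weight and a
-- negative one changes it by k, so a closed walk is positive of even length or negative of length
-- ≡ k + 1 (mod 2); in a negative closed walk each coordinate is flipped an odd number of times by
-- the negative edges, hence also by some positive edge, so the walk has at least k positive edges
-- and one negative edge. This is (k+1)-wideness, and k + 1 = g.
--
-- For g ≥ 4 the graph is simple, and the reflection through the midpoint of o = (0 , 0) and any
-- vertex c extends, after switching at the rows above c, to an involutive automorphism exchanging
-- o and c; composing two of them moves any vertex to any other. Going up column 0, along a row,
-- up column a and back to o along an edge of J gives a negative g-cycle through o and any vertex
-- of the columns 0 … a; the reflection of the columns fixing o takes care of the others. Moving
-- u to o, the cycle through o and the image of v is carried back to a cycle through u and v.
-- For g = 2 and g = 3 the symmetries and cycles are listed by hand.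

module Submission where

open import Defs
open import Data.Bool using (Bool; true; false; not; T; _∧_; _xor_; if_then_else_)
open import Data.Bool.Properties
  using (xor-same; xor-comm; xor-assoc; xor-identityʳ; xor-inverseˡ; not-involutive; ∧-zeroʳ; not-¬; ∧-distribʳ-xor; ¬-not)
open import Data.Empty using (⊥-elim)
open import Data.Fin using (Fin; zero; suc; toℕ; fromℕ; fromℕ<)
import Data.Fin.Properties as Fin
open import Data.Fin.Properties using (toℕ-injective; toℕ<n; toℕ-fromℕ<; pigeonhole)
  renaming (_≟_ to _≟ᶠ_)
open import Data.List using (List; []; _∷_; _++_; length; map)
import Data.List as List
open import Data.List.Properties using (++-assoc)
open import Data.List.Membership.Propositional using (_∈_)
open import Data.List.Membership.Propositional.Properties using (∈-++⁺ʳ; ∈-map⁺)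
open import Data.List.Relation.Unary.All using (All; []; _∷_)
import Data.List.Relation.Unary.All as All
import Data.List.Relation.Unary.All.Properties as All
open import Data.List.Relation.Unary.AllPairs using (AllPairs; []; _∷_)
import Data.List.Relation.Unary.AllPairs as AllPairs
open import Data.List.Relation.Unary.Any using (here; there; index)
open import Data.List.Relation.Unary.Any.Properties using (lookup-index)
open import Data.List.Relation.Unary.Unique.Propositional using (Unique)
import Data.List.Relation.Unary.Unique.Propositional.Properties as Unique
open import Data.Nat using (ℕ; zero; suc; ⌊_/2⌋; ⌈_/2⌉; _+_; _*_; _∸_; _≤_; _<_; _≤?_; _<?_; _≡ᵇ_; z≤n; s≤s; _%_; NonZero)
open import Data.Nat.Properties
open import Data.Nat.DivMod using ([m+n]%n≡m%n; %-distribˡ-+; m<n⇒m%n≡m; m%n<n; _mod_; n%n≡0; m%n%n≡m%n)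
open import Data.Product using (Σ; _×_; _,_; proj₁; proj₂)
open import Data.Product.Properties using (,-injectiveˡ; ,-injectiveʳ)
open import Data.Sum using (inj₁; inj₂)
open import Data.Unit using (⊤; tt)
open import Data.Vec using (Vec; []; _∷_; lookup; tabulate)
open import Data.Vec.Properties using (lookup∘tabulate; tabulate∘lookup; tabulate-cong)
open import Function using (case_of_; _∘_)
open import Function.Bundles using (_↔_; mk↔ₛ′)
open import Relation.Binary.Bundles using (Setoid)
open import Relation.Binary.PropositionalEquality
import Relation.Binary.Reasoning.Setoid as SetoidReasoning
open import Relation.Binary.Definitions using (tri<; tri≈; tri>)
open import Relation.Nullary using (¬_; Dec; yes; no; does)
open import Relation.Nullary.Decidable using (dec-true; dec-false)

xor-interchange : ∀ w x y z → (w xor x) xor (y xor z) ≡ (w xor y) xor (x xor z)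
xor-interchange w x y z = begin
  (w xor x) xor (y xor z)   ≡⟨ xor-assoc w x (y xor z) ⟩
  w xor (x xor (y xor z))   ≡⟨ cong (w xor_) (sym (xor-assoc x y z)) ⟩
  w xor ((x xor y) xor z)   ≡⟨ cong (λ t → w xor (t xor z)) (xor-comm x y) ⟩
  w xor ((y xor x) xor z)   ≡⟨ cong (w xor_) (xor-assoc y x z) ⟩
  w xor (y xor (x xor z))   ≡⟨ sym (xor-assoc w y (x xor z)) ⟩
  (w xor y) xor (x xor z)   ∎
  where open ≡-Reasoning

xor-telescope : ∀ x y z → (x xor y) xor (y xor z) ≡ x xor z
xor-telescope x y z = begin
  (x xor y) xor (y xor z)   ≡⟨ xor-assoc x y (y xor z) ⟩
  x xor (y xor (y xor z))   ≡⟨ cong (x xor_) (sym (xor-assoc y y z)) ⟩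
  x xor ((y xor y) xor z)   ≡⟨ cong (λ t → x xor (t xor z)) (xor-same y) ⟩
  x xor z                   ∎
  where open ≡-Reasoning

xor-left-comm : ∀ x y z → x xor (y xor z) ≡ y xor (x xor z)
xor-left-comm x y z = trans (sym (xor-assoc x y z)) (trans (cong (_xor z) (xor-comm x y)) (xor-assoc y x z))

xor≡false⇒≡ : ∀ {x y} → x xor y ≡ false → x ≡ y
xor≡false⇒≡ {false} {false} _ = refl
xor≡false⇒≡ {true}  {true}  _ = refl

≢⇒xor≡true : ∀ {x y} → x ≢ y → x xor y ≡ true
≢⇒xor≡true {x} {y} x≢y = trans (cong (_xor y) (¬-not x≢y)) (xor-inverseˡ y)

module _ {G : SGraph} where
  open SGraph G

  Joins-xor : ∀ (f : V → Bool) {e u v} → Joins G e u v → f (end₁ e) xor f (end₂ e) ≡ f u xor f v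
  Joins-xor f (inj₁ (refl , refl)) = refl
  Joins-xor f {e} (inj₂ (refl , refl)) = xor-comm (f (end₁ e)) (f (end₂ e))

  Joins-map : ∀ (f : V → V) {e e' u v} → Joins G e u v →
              Joins G e' (f (end₁ e)) (f (end₂ e)) → Joins G e' (f u) (f v)
  Joins-map f (inj₁ (refl , refl)) J' = J'
  Joins-map f (inj₂ (refl , refl)) (inj₁ (p , q)) = inj₂ (p , q)
  Joins-map f (inj₂ (refl , refl)) (inj₂ (p , q)) = inj₁ (p , q)

  Joins-sym : ∀ {e u v} → Joins G e u v → Joins G e v u
  Joins-sym (inj₁ (p , q)) = inj₂ (p , q)
  Joins-sym (inj₂ (p , q)) = inj₁ (p , q)

  infixr 5 _++ʷ_
  _++ʷ_ : ∀ {u v w} → Walk G u v → Walk G v w → Walk G u w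
  []           ++ʷ W' = W'
  step e J W   ++ʷ W' = step e J (W ++ʷ W')

  len-++ʷ : ∀ {u v w} (W : Walk G u v) (W' : Walk G v w) → len (W ++ʷ W') ≡ len W + len W'
  len-++ʷ []           W' = refl
  len-++ʷ (step e J W) W' = cong suc (len-++ʷ W W')

  sgn-++ʷ : ∀ {u v w} (W : Walk G u v) (W' : Walk G v w) → sgn (W ++ʷ W') ≡ sgn W xor sgn W'
  sgn-++ʷ []           W' = refl
  sgn-++ʷ (step e J W) W' = trans (cong (neg e xor_) (sgn-++ʷ W W')) (sym (xor-assoc (neg e) (sgn W) (sgn W')))

  verts-++ʷ : ∀ {u v w} (W : Walk G u v) (W' : Walk G v w) → verts (W ++ʷ W') ≡ verts W ++ verts W'
  verts-++ʷ []           W' = refl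
  verts-++ʷ (step e J W) W' = cong (_ ∷_) (verts-++ʷ W W')

  edgesOf-++ʷ : ∀ {u v w} (W : Walk G u v) (W' : Walk G v w) → edgesOf (W ++ʷ W') ≡ edgesOf W ++ edgesOf W'
  edgesOf-++ʷ []           W' = refl
  edgesOf-++ʷ (step e J W) W' = cong (e ∷_) (edgesOf-++ʷ W W')

  visits : ∀ {u w} → Walk G u w → List V
  visits {w = w} W = verts W ++ w ∷ []

  start∈visits : ∀ {u w} (W : Walk G u w) → u ∈ visits W
  start∈visits []           = here refl
  start∈visits (step e J W) = here refl

  visits-++ʷ : ∀ {u v w} (W : Walk G u v) (W' : Walk G v w) → visits (W ++ʷ W') ≡ verts W ++ visits W'
  visits-++ʷ W W' = trans (cong (_++ _) (verts-++ʷ W W')) (++-assoc (verts W) (verts W') _)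

  ∈-visits-++ʷˡ : ∀ {x u v w} (W : Walk G u v) (W' : Walk G v w) → x ∈ visits W → x ∈ visits (W ++ʷ W')
  ∈-visits-++ʷˡ []           W' (here refl)  = start∈visits W'
  ∈-visits-++ʷˡ (step e J W) W' (here refl)  = here refl
  ∈-visits-++ʷˡ (step e J W) W' (there x∈W) = there (∈-visits-++ʷˡ W W' x∈W)

  ∈-visits-++ʷʳ : ∀ {x u v w} (W : Walk G u v) (W' : Walk G v w) → x ∈ visits W' → x ∈ visits (W ++ʷ W')
  ∈-visits-++ʷʳ W W' x∈W' = subst (_ ∈_) (sym (visits-++ʷ W W')) (∈-++⁺ʳ (verts W) x∈W')

  PositiveAscent : (κ : V → ℕ) → ∀ {u w} → Walk G u w → Set
  PositiveAscent κ []                     = ⊤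
  PositiveAscent κ (step {u} {v} e J W) = κ v ≡ suc (κ u) × neg e ≡ false × PositiveAscent κ W

  module _ (κ : V → ℕ) where

    ++ʷ-ascent : ∀ {u v w} (W : Walk G u v) (W' : Walk G v w) →
                 PositiveAscent κ W → PositiveAscent κ W' → PositiveAscent κ (W ++ʷ W')
    ++ʷ-ascent []           W' _              A' = A'
    ++ʷ-ascent (step e J W) W' (up , pos , A) A' = up , pos , ++ʷ-ascent W W' A A'

    ascent-sgn : ∀ {u w} (W : Walk G u w) → PositiveAscent κ W → sgn W ≡ false
    ascent-sgn []           _             = refl
    ascent-sgn (step e J W) (_ , pos , A) = cong₂ _xor_ pos (ascent-sgn W A)

    ascent-above : ∀ {u w} (W : Walk G u w) → PositiveAscent κ W → All (λ x → κ u ≤ κ x) (visits W)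
    ascent-above []           _            = ≤-refl ∷ []
    ascent-above (step e J W) (up , _ , A) =
      ≤-refl ∷ All.map (λ v≤x → ≤-trans (≤-trans (n≤1+n _) (≤-reflexive (sym up))) v≤x) (ascent-above W A)

    ascent-visits : ∀ {u w} (W : Walk G u w) → PositiveAscent κ W → AllPairs (λ x y → κ x < κ y) (visits W)
    ascent-visits []           _            = [] ∷ []
    ascent-visits (step e J W) (up , _ , A) =
      All.map (λ v≤x → ≤-trans (≤-reflexive (sym up)) v≤x) (ascent-above W A) ∷ ascent-visits W A

    edgeKey : E → ℕ
    edgeKey e = κ (end₁ e) + κ (end₂ e)

    edgeKey-Joins : ∀ {e u v} → Joins G e u v → edgeKey e ≡ κ u + κ v
    edgeKey-Joins (inj₁ (refl , refl)) = refl
    edgeKey-Joins {e} (inj₂ (refl , refl)) = +-comm (κ (end₁ e)) (κ (end₂ e))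

    ascent-edges-above : ∀ {u w} (W : Walk G u w) → PositiveAscent κ W → All (λ e → κ u + κ u < edgeKey e) (edgesOf W)
    ascent-edges-above []           _ = []
    ascent-edges-above {u} (step {v = v} e J W) (up , _ , A) =
      ≤-trans (≤-reflexive (trans (sym (+-suc (κ u) (κ u))) (cong (κ u +_) (sym up)))) (≤-reflexive (sym (edgeKey-Joins J)))
      ∷ All.map (<-trans u+u<v+v) (ascent-edges-above W A)
      where
      u+u<v+v : κ u + κ u < κ v + κ v
      u+u<v+v = subst₂ (λ p q → κ u + κ u < p + q) (sym up) (sym up) (+-mono-< (n<1+n (κ u)) (n<1+n (κ u)))

    ascent-edges : ∀ {u w} (W : Walk G u w) → PositiveAscent κ W → AllPairs (λ e e' → edgeKey e < edgeKey e') (edgesOf W)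
    ascent-edges []           _ = []
    ascent-edges {u} (step {v = v} e J W) (up , _ , A) =
      All.map (<-trans e<v+v) (ascent-edges-above W A) ∷ ascent-edges W A
      where
      e<v+v : edgeKey e < κ v + κ v
      e<v+v = ≤-reflexive (trans (cong suc (edgeKey-Joins J)) (subst (λ t → suc (κ u + t) ≡ t + t) (sym up) refl))

    ascent-positive : ∀ {u w} (W : Walk G u w) → PositiveAscent κ W → All (λ e → neg e ≡ false) (edgesOf W)
    ascent-positive []           _             = []
    ascent-positive (step e J W) (_ , pos , A) = pos ∷ ascent-positive W A

    ascent-closing-isCycle : ∀ {u w} (P : Walk G u w) → PositiveAscent κ P →
                             ∀ {e} → neg e ≡ true → (J : Joins G e w u) → IsCycle G (P ++ʷ step e J [])
    ascent-closing-isCycle P A {e} e⁻ J =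
      subst (1 ≤_) (sym (len-++ʷ P _)) (m≤n+m 1 (len P)) ,
      subst Unique (sym (verts-++ʷ P _)) (AllPairs.map (λ κx<κy x≡y → <-irrefl (cong κ x≡y) κx<κy) (ascent-visits P A)) ,
      subst Unique (sym (edgesOf-++ʷ P _))
        (Unique.++⁺ (AllPairs.map (λ k<k' e≡e' → <-irrefl (cong edgeKey e≡e') k<k') (ascent-edges P A))
                    ([] ∷ [])
                    λ { (e∈P , here refl) → case trans (sym (All.lookup (ascent-positive P A) e∈P)) e⁻ of λ () })

    ascent-closing-sgn : ∀ {u w} (P : Walk G u w) → PositiveAscent κ P →
                         ∀ {e} → neg e ≡ true → (J : Joins G e w u) → sgn (P ++ʷ step e J []) ≡ true
    ascent-closing-sgn P A {e} e⁻ J =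
      trans (sgn-++ʷ P _) (cong₂ _xor_ (ascent-sgn P A) (cong (_xor false) e⁻))

-- Involutive automorphisms up to switching

NegCycleThrough : ℕ → (G : SGraph) → SGraph.V G → SGraph.V G → Set
NegCycleThrough g G u v = Σ (SGraph.V G) λ x → Σ (Walk G x x) λ W →
  IsCycle G W × len W ≡ g × sgn W ≡ true × u ∈ verts W × v ∈ verts W

record SwitchingInvolution (G : SGraph) : Set where
  open SGraph G
  field
    φ            : V → V
    ψ            : E → E
    φ-involutive : ∀ x → φ (φ x) ≡ x
    ψ-involutive : ∀ e → ψ (ψ e) ≡ e
    ψ-joins      : ∀ e → Joins G (ψ e) (φ (end₁ e)) (φ (end₂ e))
    switch       : V → Bool
    neg-ψ        : ∀ e → neg (ψ e) ≡ neg e xor (switch (φ (end₁ e)) xor switch (φ (end₂ e)))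

  φ-injective : ∀ {x y} → φ x ≡ φ y → x ≡ y
  φ-injective {x} {y} p = trans (sym (φ-involutive x)) (trans (cong φ p) (φ-involutive y))

  ψ-injective : ∀ {e f} → ψ e ≡ ψ f → e ≡ f
  ψ-injective {e} {f} p = trans (sym (ψ-involutive e)) (trans (cong ψ p) (ψ-involutive f))

  mapʷ : ∀ {x y} → Walk G x y → Walk G (φ x) (φ y)
  mapʷ []           = []
  mapʷ (step e J W) = step (ψ e) (Joins-map {G = G} φ J (ψ-joins e)) (mapʷ W)

  len-mapʷ : ∀ {x y} (W : Walk G x y) → len (mapʷ W) ≡ len W
  len-mapʷ []           = refl
  len-mapʷ (step e J W) = cong suc (len-mapʷ W)

  verts-mapʷ : ∀ {x y} (W : Walk G x y) → verts (mapʷ W) ≡ map φ (verts W)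
  verts-mapʷ []           = refl
  verts-mapʷ (step e J W) = cong (_ ∷_) (verts-mapʷ W)

  edgesOf-mapʷ : ∀ {x y} (W : Walk G x y) → edgesOf (mapʷ W) ≡ map ψ (edgesOf W)
  edgesOf-mapʷ []           = refl
  edgesOf-mapʷ (step e J W) = cong (_ ∷_) (edgesOf-mapʷ W)

  sgn-mapʷ : ∀ {x y} (W : Walk G x y) → sgn (mapʷ W) ≡ sgn W xor (switch (φ x) xor switch (φ y))
  sgn-mapʷ {x} []           = sym (xor-same (switch (φ x)))
  sgn-mapʷ {x} {y} (step {v = v} e J W) = begin
    neg (ψ e) xor sgn (mapʷ W)
      ≡⟨ cong₂ _xor_ (trans (neg-ψ e) (cong (neg e xor_) (Joins-xor {G = G} (λ z → switch (φ z)) J))) (sgn-mapʷ W) ⟩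
    (neg e xor (sx xor sv)) xor (sgn W xor (sv xor sy))
      ≡⟨ xor-interchange (neg e) (sx xor sv) (sgn W) (sv xor sy) ⟩
    (neg e xor sgn W) xor ((sx xor sv) xor (sv xor sy))
      ≡⟨ cong ((neg e xor sgn W) xor_) (xor-telescope sx sv sy) ⟩
    (neg e xor sgn W) xor (sx xor sy) ∎
    where
    open ≡-Reasoning
    sx sv sy : Bool
    sx = switch (φ x)
    sv = switch (φ v)
    sy = switch (φ y)

  mapʷ-negCycle : ∀ {g u v} → NegCycleThrough g G u v → NegCycleThrough g G (φ u) (φ v)
  mapʷ-negCycle {u = u} {v} (x , W , (1≤len , uniqueVerts , uniqueEdges) , len≡g , W⁻ , u∈W , v∈W) =
    φ x , mapʷ W ,
    (subst (1 ≤_) (sym (len-mapʷ W)) 1≤len ,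
     subst Unique (sym (verts-mapʷ W)) (Unique.map⁺ φ-injective uniqueVerts) ,
     subst Unique (sym (edgesOf-mapʷ W)) (Unique.map⁺ ψ-injective uniqueEdges)) ,
    trans (len-mapʷ W) len≡g ,
    trans (sgn-mapʷ W) (trans (cong (_xor _) W⁻) (cong (true xor_) (xor-same (switch (φ x))))) ,
    subst (φ u ∈_) (sym (verts-mapʷ W)) (∈-map⁺ φ u∈W) ,
    subst (φ v ∈_) (sym (verts-mapʷ W)) (∈-map⁺ φ v∈W)

involution-∘-↔ : ∀ {A : Set} (f h : A → A) → (∀ x → f (f x) ≡ x) → (∀ x → h (h x) ≡ x) → A ↔ A
involution-∘-↔ f h ff hh = mk↔ₛ′ (λ x → h (f x)) (λ x → f (h x))
  (λ y → trans (cong h (ff (h y))) (hh y))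
  (λ x → trans (cong f (hh (f x))) (ff x))

module _ {G : SGraph} where
  open SGraph G

  ToBase : V → Set
  ToBase o = ∀ u → Σ (SwitchingInvolution G) λ S → SwitchingInvolution.φ S u ≡ o

  private
    from-base : ∀ {o} (S : SwitchingInvolution G) {u} → SwitchingInvolution.φ S u ≡ o → SwitchingInvolution.φ S o ≡ u
    from-base S {u} refl = φ-involutive u
      where open SwitchingInvolution S

    swap-xor : ∀ n n' x y → n' ≡ (n xor x) xor y → n ≡ n' xor (y xor x)
    swap-xor n n' x y refl = begin
      n                               ≡⟨ sym (xor-identityʳ n) ⟩
      n xor false                     ≡⟨ cong (n xor_) (sym (xor-same x)) ⟩
      n xor (x xor x)                 ≡⟨ sym (xor-assoc n x x) ⟩
      (n xor x) xor x                 ≡⟨ sym (xor-telescope (n xor x) y x) ⟩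
      ((n xor x) xor y) xor (y xor x) ∎
      where open ≡-Reasoning

  vertexTransitive-viaInvolutions : (o : V) → ToBase o → VertexTransitive G
  vertexTransitive-viaInvolutions o toBase u v =
    involution-∘-↔ A.φ B.φ A.φ-involutive B.φ-involutive ,
    involution-∘-↔ A.ψ B.ψ A.ψ-involutive B.ψ-involutive ,
    trans (cong B.φ (proj₂ (toBase u))) (from-base (proj₁ (toBase v)) (proj₂ (toBase v))) ,
    (λ e → Joins-map {G = G} B.φ (A.ψ-joins e) (B.ψ-joins (A.ψ e))) ,
    Z , Z-switches
    where
    module A = SwitchingInvolution (proj₁ (toBase u))
    module B = SwitchingInvolution (proj₁ (toBase v))
    Z : V → Bool
    Z y = B.switch y xor A.switch (B.φ y)
    Z-switches : ∀ e → neg e ≡ neg (B.ψ (A.ψ e)) xor (Z (end₁ (B.ψ (A.ψ e))) xor Z (end₂ (B.ψ (A.ψ e))))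
    Z-switches e =
      trans (swap-xor (neg e) (neg (B.ψ f)) dA dB (trans (B.neg-ψ f) (cong (_xor dB) (A.neg-ψ e))))
            (cong (neg (B.ψ f) xor_) Z-sum)
      where
      f : E
      f = A.ψ e
      dA dB : Bool
      dA = A.switch (A.φ (end₁ e)) xor A.switch (A.φ (end₂ e))
      dB = B.switch (B.φ (end₁ f)) xor B.switch (B.φ (end₂ f))
      Z-sum : dB xor dA ≡ Z (end₁ (B.ψ f)) xor Z (end₂ (B.ψ f))
      Z-sum = begin
        dB xor dA
          ≡⟨ cong (dB xor_) (sym (Joins-xor {G = G} A.switch (A.ψ-joins e))) ⟩
        dB xor (A.switch (end₁ f) xor A.switch (end₂ f))
          ≡⟨ xor-interchange (B.switch (B.φ (end₁ f))) _ _ _ ⟩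
        (B.switch (B.φ (end₁ f)) xor A.switch (end₁ f)) xor (B.switch (B.φ (end₂ f)) xor A.switch (end₂ f))
          ≡⟨ cong₂ (λ x y → (B.switch (B.φ (end₁ f)) xor A.switch x) xor (B.switch (B.φ (end₂ f)) xor A.switch y))
                   (sym (B.φ-involutive (end₁ f))) (sym (B.φ-involutive (end₂ f))) ⟩
        Z (B.φ (end₁ f)) xor Z (B.φ (end₂ f))
          ≡⟨ sym (Joins-xor {G = G} Z (B.ψ-joins f)) ⟩
        Z (end₁ (B.ψ f)) xor Z (end₂ (B.ψ f)) ∎
        where open ≡-Reasoning

  negCycles-viaInvolutions : ∀ {g} (o : V) → ToBase o → (∀ w → NegCycleThrough g G o w) → NegCyclesThroughPairs g G
  negCycles-viaInvolutions {g} o toBase cycle u v =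
    subst₂ (NegCycleThrough g G) (from-base S (proj₂ (toBase u))) (φ-involutive v) (mapʷ-negCycle (cycle (φ v)))
    where
    S : SwitchingInvolution G
    S = proj₁ (toBase u)
    open SwitchingInvolution S

involutionsToBase⇒symmetric : ∀ {g} {G : SGraph} →
  (Σ (SGraph.V G) λ o → ToBase {G = G} o × (∀ w → NegCycleThrough g G o w)) →
  VertexTransitive G × NegCyclesThroughPairs g G
involutionsToBase⇒symmetric (o , toBase , negCycle) =
  vertexTransitive-viaInvolutions o toBase , negCycles-viaInvolutions o toBase negCycle

module _ {G : SGraph} where
  open SGraph G

  NoParallelEdges : Set
  NoParallelEdges = ∀ {e f u v} → Joins G e u v → Joins G f u v → e ≡ f

  record EdgeImage (φ : V → V) (switch : V → Bool) (e : E) : Set where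
    field
      edge  : E
      joins : Joins G edge (φ (end₁ e)) (φ (end₂ e))
      sign  : neg edge ≡ neg e xor (switch (φ (end₁ e)) xor switch (φ (end₂ e)))

  -- Without parallel edges an edge is determined by its ends, so ψ inherits involutivity from φ.
  switchingInvolution : NoParallelEdges → (φ : V → V) → (∀ x → φ (φ x) ≡ x) →
                        (switch : V → Bool) → (∀ e → EdgeImage φ switch e) → SwitchingInvolution G
  switchingInvolution simple φ φφ switch image = record
    { φ = φ ; ψ = ψ ; φ-involutive = φφ ; ψ-involutive = ψψ
    ; ψ-joins = λ e → EdgeImage.joins (image e) ; switch = switch
    ; neg-ψ = λ e → EdgeImage.sign (image e) }
    where
    ψ : E → E
    ψ e = EdgeImage.edge (image e)
    ψψ : ∀ e → ψ (ψ e) ≡ e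
    ψψ e = simple (subst₂ (Joins G (ψ (ψ e))) (φφ (end₁ e)) (φφ (end₂ e))
                     (Joins-map {G = G} φ (EdgeImage.joins (image e)) (EdgeImage.joins (image (ψ e)))))
                  (inj₁ (refl , refl))

toℕ-csuc : ∀ {n} .{{_ : NonZero n}} (i : Fin n) → toℕ (csuc i) ≡ suc (toℕ i) % n
toℕ-csuc {suc n} i with suc (toℕ i) <? suc n
... | yes p = trans (toℕ-fromℕ< p) (sym (m<n⇒m%n≡m p))
... | no ¬p = sym (trans (cong (_% suc n) (≤-antisym (toℕ<n i) (≮⇒≥ ¬p))) (n%n≡0 (suc n)))

toℕ-csuc-< : ∀ {n} .{{_ : NonZero n}} (i : Fin n) → suc (toℕ i) < n → toℕ (csuc i) ≡ suc (toℕ i)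
toℕ-csuc-< i p = trans (toℕ-csuc i) (m<n⇒m%n≡m p)

csuc-last : ∀ {n} (i : Fin (suc n)) → suc (toℕ i) ≡ suc n → csuc i ≡ zero
csuc-last {n} i p = toℕ-injective (trans (toℕ-csuc i) (trans (cong (_% suc n) p) (n%n≡0 (suc n))))

iter-commute : ∀ {A : Set} k (f : A → A) x → iter k f (f x) ≡ f (iter k f x)
iter-commute zero    f x = refl
iter-commute (suc k) f x = cong f (iter-commute k f x)

+-suc-≡⇒< : ∀ {x m y} → x + suc m ≡ y → x < y
+-suc-≡⇒< {x} {m} refl = subst (_≤ x + suc m) (+-comm x 1) (+-monoʳ-≤ x (s≤s z≤n))

straight-step-< : ∀ {N} {j j′ : Fin N} {m} → toℕ j + suc m ≡ toℕ j′ → suc (toℕ j) < N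
straight-step-< {j′ = j′} eq = ≤-<-trans (+-suc-≡⇒< eq) (toℕ<n j′)

module _ {k : ℕ} where

  toℕ-csuc-forward : ∀ (x : Fin (suc k)) m → toℕ x + suc (suc m) ≡ suc k → toℕ (csuc x) ≡ suc (toℕ x)
  toℕ-csuc-forward x m eq = toℕ-csuc-< x (+-suc-≡⇒< (trans (sym (+-suc (toℕ x) (suc m))) eq))

  forward-next : ∀ (x : Fin (suc k)) m → toℕ x + suc (suc m) ≡ suc k → toℕ (csuc x) + suc m ≡ suc k
  forward-next x m eq = trans (cong (_+ suc m) (toℕ-csuc-forward x m eq)) (trans (sym (+-suc (toℕ x) (suc m))) eq)

  forward : (x : Fin (suc k)) (m : ℕ) → toℕ x + suc m ≡ suc k → Walk (Cneg (suc k)) x zero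
  forward x zero    eq = step x (inj₁ (refl , csuc-last x (trans (+-comm 1 (toℕ x)) eq))) []
  forward x (suc m) eq = step x (inj₁ (refl , refl)) (forward (csuc x) m (forward-next x m eq))

  len-forward : ∀ x m eq → len (forward x m eq) ≡ suc m
  len-forward x zero    eq = refl
  len-forward x (suc m) eq = cong suc (len-forward (csuc x) m _)

  sgn-forward : ∀ x m eq → sgn (forward x m eq) ≡ (toℕ x ≡ᵇ 0)
  sgn-forward x zero    eq = xor-identityʳ _
  sgn-forward x (suc m) eq = begin
    (toℕ x ≡ᵇ 0) xor sgn (forward (csuc x) m _) ≡⟨ cong ((toℕ x ≡ᵇ 0) xor_) (sgn-forward (csuc x) m _) ⟩
    (toℕ x ≡ᵇ 0) xor (toℕ (csuc x) ≡ᵇ 0)       ≡⟨ cong (λ t → (toℕ x ≡ᵇ 0) xor (t ≡ᵇ 0)) (toℕ-csuc-forward x m eq) ⟩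
    (toℕ x ≡ᵇ 0) xor false                      ≡⟨ xor-identityʳ _ ⟩
    (toℕ x ≡ᵇ 0)                                ∎
    where open ≡-Reasoning

  Cneg-loop : Walk (Cneg (suc k)) zero zero
  Cneg-loop = forward zero k refl

-- Subgraphs of SPC(k) are (k+1)-wide

odd : ℕ → Bool
odd zero    = false
odd (suc n) = not (odd n)

%2-odd : ∀ n → n % 2 ≡ (if odd n then 1 else 0)
%2-odd zero          = refl
%2-odd (suc zero)    = refl
%2-odd (suc (suc n)) = begin
  suc (suc n) % 2                  ≡⟨ cong (_% 2) (+-comm 2 n) ⟩
  (n + 2) % 2                      ≡⟨ [m+n]%n≡m%n n 2 ⟩
  n % 2                            ≡⟨ %2-odd n ⟩
  (if odd n then 1 else 0)         ≡⟨ cong (if_then 1 else 0) (sym (not-involutive (odd n))) ⟩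
  (if odd (suc (suc n)) then 1 else 0) ∎
  where open ≡-Reasoning

odd⇒%2 : ∀ m n → odd m ≡ odd n → m % 2 ≡ n % 2
odd⇒%2 m n eq = trans (%2-odd m) (trans (cong (if_then 1 else 0) eq) (sym (%2-odd n)))

parity : ∀ {k} → Vec Bool k → Bool
parity []       = false
parity (x ∷ xs) = x xor parity xs

lookup-ext : ∀ {k} {xs ys : Vec Bool k} → (∀ c → lookup xs c ≡ lookup ys c) → xs ≡ ys
lookup-ext {xs = xs} {ys} eq = trans (sym (tabulate∘lookup xs)) (trans (tabulate-cong eq) (tabulate∘lookup ys))

parity-differInExactlyOne : ∀ {k} (xs ys : Vec Bool k) → DifferInExactlyOne xs ys → parity xs xor parity ys ≡ true
parity-differInExactlyOne (x ∷ xs) (y ∷ ys) (zero , x≢y , rest) = begin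
  (x xor parity xs) xor (y xor parity ys) ≡⟨ xor-interchange x _ y _ ⟩
  (x xor y) xor (parity xs xor parity ys) ≡⟨ cong₂ _xor_ (≢⇒xor≡true x≢y) (cong (λ zs → parity xs xor parity zs) (sym xs≡ys)) ⟩
  true xor (parity xs xor parity xs)      ≡⟨ cong (true xor_) (xor-same (parity xs)) ⟩
  true                                    ∎
  where
  open ≡-Reasoning
  xs≡ys : xs ≡ ys
  xs≡ys = lookup-ext (λ c → rest (suc c) λ ())
parity-differInExactlyOne (x ∷ xs) (y ∷ ys) (suc c , differs , rest) = begin
  (x xor parity xs) xor (y xor parity ys) ≡⟨ xor-interchange x _ y _ ⟩
  (x xor y) xor (parity xs xor parity ys) ≡⟨ cong₂ _xor_ (trans (cong (x xor_) (sym (rest zero λ ()))) (xor-same x))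
                                                        (parity-differInExactlyOne xs ys tails-differ) ⟩
  true                                    ∎
  where
  open ≡-Reasoning
  tails-differ : DifferInExactlyOne xs ys
  tails-differ = c , differs , λ c′ c′≢c → rest (suc c′) (c′≢c ∘ Fin.suc-injective)

parity-differInAll : ∀ {k} (xs ys : Vec Bool k) → DifferInAll xs ys → parity xs xor parity ys ≡ odd k
parity-differInAll []       []       _       = refl
parity-differInAll {suc k} (x ∷ xs) (y ∷ ys) differs = begin
  (x xor parity xs) xor (y xor parity ys) ≡⟨ xor-interchange x _ y _ ⟩
  (x xor y) xor (parity xs xor parity ys) ≡⟨ cong₂ _xor_ (≢⇒xor≡true (differs zero)) (parity-differInAll xs ys (differs ∘ suc)) ⟩
  not (odd k)                             ∎
  where open ≡-Reasoning

differInExactlyOne-lookup : ∀ {k} (xs ys : Vec Bool k) (D : DifferInExactlyOne xs ys) (c : Fin k) →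
                            lookup xs c xor lookup ys c ≡ does (c ≟ᶠ proj₁ D)
differInExactlyOne-lookup xs ys (c₀ , differs , rest) c with c ≟ᶠ c₀
... | yes refl = ≢⇒xor≡true differs
... | no c≢c₀  = trans (cong (_xor lookup ys c) (rest c c≢c₀)) (xor-same (lookup ys c))

occursOddly : ∀ {k} → Fin k → List (Fin k) → Bool
occursOddly c []        = false
occursOddly c (c′ ∷ cs) = does (c ≟ᶠ c′) xor occursOddly c cs

occursOddly⇒∈ : ∀ {k} (c : Fin k) cs → occursOddly c cs ≡ true → c ∈ cs
occursOddly⇒∈ c (c′ ∷ cs) odd with c ≟ᶠ c′
... | yes c≡c′ = here c≡c′
... | no _     = there (occursOddly⇒∈ c cs odd)

covering⇒≤length : ∀ {k} (cs : List (Fin k)) → (∀ c → c ∈ cs) → k ≤ length cs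
covering⇒≤length {k} cs covers with k ≤? length cs
... | yes k≤ = k≤
... | no  k≰ with pigeonhole (≰⇒> k≰) (λ c → index (covers c))
...   | i , j , i<j , same = ⊥-elim (<-irrefl (cong toℕ i≡j) i<j)
  where
  i≡j : i ≡ j
  i≡j = trans (lookup-index (covers i)) (trans (cong (List.lookup cs) same) (sym (lookup-index (covers j))))

module _ {G : SGraph} {k : ℕ} (embedding : SubgraphOfSPC G k) where
  open SGraph G

  private
    φ : V → Vec Bool k
    φ = proj₁ embedding
    positive-differs : ∀ e → neg e ≡ false → DifferInExactlyOne (φ (end₁ e)) (φ (end₂ e))
    positive-differs = proj₁ (proj₂ (proj₂ embedding))
    negative-differs : ∀ e → neg e ≡ true → DifferInAll (φ (end₁ e)) (φ (end₂ e))
    negative-differs = proj₂ (proj₂ (proj₂ embedding))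

  positiveParity : ∀ {u w} → Walk G u w → Bool
  positiveParity []           = false
  positiveParity (step e _ W) = not (neg e) xor positiveParity W

  odd-len : ∀ {u w} (W : Walk G u w) → odd (len W) ≡ positiveParity W xor sgn W
  odd-len []           = refl
  odd-len (step e J W) = begin
    not (odd (len W))                              ≡⟨ cong not (odd-len W) ⟩
    not (positiveParity W xor sgn W)               ≡⟨ cong (_xor (positiveParity W xor sgn W)) (sym (xor-inverseˡ (neg e))) ⟩
    (not (neg e) xor neg e) xor (positiveParity W xor sgn W)
                                                   ≡⟨ xor-interchange (not (neg e)) (neg e) _ _ ⟩
    (not (neg e) xor positiveParity W) xor (neg e xor sgn W) ∎
    where open ≡-Reasoning

  parity-edge : ∀ e → parity (φ (end₁ e)) xor parity (φ (end₂ e)) ≡ not (neg e) xor (neg e ∧ odd k)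
  parity-edge e with neg e | positive-differs e | negative-differs e
  ... | true  | _  | D⁻ = parity-differInAll (φ (end₁ e)) (φ (end₂ e)) (D⁻ refl)
  ... | false | D⁺ | _  = parity-differInExactlyOne (φ (end₁ e)) (φ (end₂ e)) (D⁺ refl)

  parity-walk : ∀ {u w} (W : Walk G u w) →
                parity (φ u) xor parity (φ w) ≡ positiveParity W xor (sgn W ∧ odd k)
  parity-walk {u} []                         = xor-same (parity (φ u))
  parity-walk {u} {w} (step {v = v} e J W) = begin
    parity (φ u) xor parity (φ w)
      ≡⟨ sym (xor-telescope (parity (φ u)) (parity (φ v)) (parity (φ w))) ⟩
    (parity (φ u) xor parity (φ v)) xor (parity (φ v) xor parity (φ w))
      ≡⟨ cong₂ _xor_ (trans (sym (Joins-xor {G = G} (λ x → parity (φ x)) J)) (parity-edge e)) (parity-walk W) ⟩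
    (not (neg e) xor (neg e ∧ odd k)) xor (positiveParity W xor (sgn W ∧ odd k))
      ≡⟨ xor-interchange (not (neg e)) _ _ _ ⟩
    (not (neg e) xor positiveParity W) xor ((neg e ∧ odd k) xor (sgn W ∧ odd k))
      ≡⟨ cong ((not (neg e) xor positiveParity W) xor_) (sym (∧-distribʳ-xor (odd k) (neg e) (sgn W))) ⟩
    (not (neg e) xor positiveParity W) xor ((neg e xor sgn W) ∧ odd k) ∎
    where open ≡-Reasoning

  closed-odd-len : ∀ {v} (W : Walk G v v) → odd (len W) ≡ sgn W ∧ not (odd k)
  closed-odd-len {v} W = trans (odd-len W) (trans (cong (_xor sgn W) positiveParity≡) (∧-xor-self (sgn W) (odd k)))
    where
    ∧-xor-self : ∀ s o → (s ∧ o) xor s ≡ s ∧ not o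
    ∧-xor-self false o = refl
    ∧-xor-self true  o = xor-comm o true
    positiveParity≡ : positiveParity W ≡ sgn W ∧ odd k
    positiveParity≡ = xor≡false⇒≡ (trans (sym (parity-walk W)) (xor-same (parity (φ v))))

  positiveCoords : ∀ {u w} → Walk G u w → List (Fin k)
  positiveCoords []           = []
  positiveCoords (step e _ W) with neg e | positive-differs e
  ... | true  | _  = positiveCoords W
  ... | false | D⁺ = proj₁ (D⁺ refl) ∷ positiveCoords W

  coordinate-walk : ∀ (c : Fin k) {u w} (W : Walk G u w) →
                    lookup (φ u) c xor lookup (φ w) c ≡ sgn W xor occursOddly c (positiveCoords W)
  coordinate-walk c {u} []                       = xor-same (lookup (φ u) c)
  coordinate-walk c {u} {w} (step {v = v} e J W) with neg e | positive-differs e | negative-differs e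
  ... | true | _ | D⁻ = begin
    lookup (φ u) c xor lookup (φ w) c
      ≡⟨ sym (xor-telescope (lookup (φ u) c) (lookup (φ v) c) (lookup (φ w) c)) ⟩
    (lookup (φ u) c xor lookup (φ v) c) xor (lookup (φ v) c xor lookup (φ w) c)
      ≡⟨ cong₂ _xor_ (trans (sym (Joins-xor {G = G} (λ x → lookup (φ x) c) J)) (≢⇒xor≡true (D⁻ refl c)))
                     (coordinate-walk c W) ⟩
    true xor (sgn W xor occursOddly c (positiveCoords W))
      ≡⟨ sym (xor-assoc true (sgn W) _) ⟩
    (true xor sgn W) xor occursOddly c (positiveCoords W) ∎
    where open ≡-Reasoning
  ... | false | D⁺ | _ = begin
    lookup (φ u) c xor lookup (φ w) c
      ≡⟨ sym (xor-telescope (lookup (φ u) c) (lookup (φ v) c) (lookup (φ w) c)) ⟩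
    (lookup (φ u) c xor lookup (φ v) c) xor (lookup (φ v) c xor lookup (φ w) c)
      ≡⟨ cong₂ _xor_ (trans (sym (Joins-xor {G = G} (λ x → lookup (φ x) c) J))
                            (differInExactlyOne-lookup (φ (end₁ e)) (φ (end₂ e)) D c))
                     (coordinate-walk c W) ⟩
    does (c ≟ᶠ proj₁ D) xor (sgn W xor occursOddly c (positiveCoords W))
      ≡⟨ xor-left-comm (does (c ≟ᶠ proj₁ D)) (sgn W) _ ⟩
    sgn W xor (does (c ≟ᶠ proj₁ D) xor occursOddly c (positiveCoords W)) ∎
    where
    open ≡-Reasoning
    D : DifferInExactlyOne (φ (end₁ e)) (φ (end₂ e))
    D = D⁺ refl

  negative-closed-covers : ∀ {v} (W : Walk G v v) → sgn W ≡ true → ∀ c → c ∈ positiveCoords W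
  negative-closed-covers {v} W W⁻ c = occursOddly⇒∈ c (positiveCoords W)
    (sym (xor≡false⇒≡ (trans (cong (_xor occursOddly c (positiveCoords W)) (sym W⁻))
                             (trans (sym (coordinate-walk c W)) (xor-same (lookup (φ v) c))))))

  length-positiveCoords : ∀ {u w} (W : Walk G u w) → length (positiveCoords W) ≤ len W
  length-positiveCoords []           = z≤n
  length-positiveCoords (step e J W) with neg e | positive-differs e
  ... | true  | _ = m≤n⇒m≤1+n (length-positiveCoords W)
  ... | false | _ = s≤s (length-positiveCoords W)

  length-positiveCoords-< : ∀ {u w} (W : Walk G u w) → sgn W ≡ true → length (positiveCoords W) < len W
  length-positiveCoords-< (step e J W) W⁻ with neg e | positive-differs e
  ... | true  | _ = s≤s (length-positiveCoords W)
  ... | false | _ = s≤s (length-positiveCoords-< W W⁻)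

  SPC⇒wide : Wide (suc k) G
  SPC⇒wide v W
    with sgn W | closed-odd-len W | negative-closed-covers W | length-positiveCoords-< W
  ... | false | odd-W | _      | _      = zero , [] , refl , odd⇒%2 0 (len W) (sym odd-W) , z≤n
  ... | true  | odd-W | covers | short  =
    zero , Cneg-loop , sgn-forward zero k refl , odd⇒%2 (len (Cneg-loop {k})) (len W) (trans (cong odd len-loop) (sym odd-W)) ,
    ≤-trans (≤-reflexive len-loop) (≤-trans (s≤s (covering⇒≤length (positiveCoords W) (covers refl))) (short refl))
    where
    len-loop : len (Cneg-loop {k}) ≡ suc k
    len-loop = len-forward zero k refl

-- Arithmetic modulo n

module Modular (n : ℕ) .{{_ : NonZero n}} where

  -- a record rather than a synonym, so that x and y can be inferred from a proof of x ≈ y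
  infix 4 _≈_
  record _≈_ (x y : ℕ) : Set where
    constructor mod≡
    field %-≡ : x % n ≡ y % n

  ≈-setoid : Setoid _ _
  ≈-setoid = record
    { Carrier = ℕ ; _≈_ = _≈_
    ; isEquivalence = record
      { refl  = mod≡ refl
      ; sym   = λ (mod≡ p) → mod≡ (sym p)
      ; trans = λ (mod≡ p) (mod≡ q) → mod≡ (trans p q) } }

  ≈-reflexive : ∀ {x y} → x ≡ y → x ≈ y
  ≈-reflexive refl = mod≡ refl

  +-≈ : ∀ {x y u v} → x ≈ y → u ≈ v → x + u ≈ y + v
  +-≈ {x} {y} {u} {v} (mod≡ p) (mod≡ q) = mod≡ (begin
    (x + u) % n             ≡⟨ %-distribˡ-+ x u n ⟩
    (x % n + u % n) % n     ≡⟨ cong₂ (λ s t → (s + t) % n) p q ⟩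
    (y % n + v % n) % n     ≡⟨ %-distribˡ-+ y v n ⟨
    (y + v) % n             ∎)
    where open ≡-Reasoning

  +n-≈ : ∀ x → x + n ≈ x
  +n-≈ x = mod≡ ([m+n]%n≡m%n x n)

  +-cancelʳ-≈ : ∀ {x y z} → z ≤ n → x + z ≈ y + z → x ≈ y
  +-cancelʳ-≈ {x} {y} {z} z≤ x+z≈y+z = begin
    x                   ≈⟨ +n-≈ x ⟨
    x + n               ≡⟨ cong (x +_) (m+[n∸m]≡n z≤) ⟨
    x + (z + (n ∸ z))   ≡⟨ +-assoc x z (n ∸ z) ⟨
    x + z + (n ∸ z)     ≈⟨ +-≈ x+z≈y+z (mod≡ refl) ⟩
    y + z + (n ∸ z)     ≡⟨ +-assoc y z (n ∸ z) ⟩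
    y + (z + (n ∸ z))   ≡⟨ cong (y +_) (m+[n∸m]≡n z≤) ⟩
    y + n               ≈⟨ +n-≈ y ⟩
    y                   ∎
    where open SetoidReasoning ≈-setoid

  ≈⇒≡ : ∀ {x y} → x < n → y < n → x ≈ y → x ≡ y
  ≈⇒≡ x<n y<n (mod≡ p) = trans (sym (m<n⇒m%n≡m x<n)) (trans p (m<n⇒m%n≡m y<n))

  toℕ-≈-injective : ∀ {i j : Fin n} → toℕ i ≈ toℕ j → i ≡ j
  toℕ-≈-injective {i} {j} p = toℕ-injective (≈⇒≡ (toℕ<n i) (toℕ<n j) p)

  suc-≈ : ∀ {x y} → x ≈ y → suc x ≈ suc y
  suc-≈ = +-≈ {1} {1} (mod≡ refl)

  csuc-≈ : ∀ (i : Fin n) → toℕ (csuc i) ≈ suc (toℕ i)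
  csuc-≈ i = mod≡ (trans (cong (_% n) (toℕ-csuc i)) (m%n%n≡m%n (suc (toℕ i)) n))

  addMod-≈ : ∀ k (i : Fin n) → toℕ (addMod k i) ≈ toℕ i + k
  addMod-≈ zero    i = ≈-reflexive (sym (+-identityʳ (toℕ i)))
  addMod-≈ (suc k) i = begin
    toℕ (csuc (addMod k i))   ≈⟨ csuc-≈ (addMod k i) ⟩
    suc (toℕ (addMod k i))    ≈⟨ suc-≈ (addMod-≈ k i) ⟩
    suc (toℕ i + k)           ≡⟨ +-suc (toℕ i) k ⟨
    toℕ i + suc k             ∎
    where open SetoidReasoning ≈-setoid

  infixl 6 _⊖_
  _⊖_ : Fin n → Fin n → Fin n
  c ⊖ i = (toℕ c + (n ∸ toℕ i)) mod n

  toℕ-⊖ : ∀ c i → toℕ (c ⊖ i) ≡ (toℕ c + (n ∸ toℕ i)) % n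
  toℕ-⊖ c i = toℕ-fromℕ< (m%n<n (toℕ c + (n ∸ toℕ i)) n)

  ⊖-≈ : ∀ c i → toℕ (c ⊖ i) + toℕ i ≈ toℕ c
  ⊖-≈ c i = begin
    toℕ (c ⊖ i) + toℕ i                  ≈⟨ +-≈ (mod≡ (trans (cong (_% n) (toℕ-⊖ c i)) (m%n%n≡m%n _ n))) (mod≡ refl) ⟩
    toℕ c + (n ∸ toℕ i) + toℕ i          ≡⟨ +-assoc (toℕ c) (n ∸ toℕ i) (toℕ i) ⟩
    toℕ c + (n ∸ toℕ i + toℕ i)          ≡⟨ cong (toℕ c +_) (m∸n+n≡m (<⇒≤ (toℕ<n i))) ⟩
    toℕ c + n                            ≈⟨ +n-≈ (toℕ c) ⟩
    toℕ c                                ∎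
    where open SetoidReasoning ≈-setoid

  ⊖-unique : ∀ {c i x} → toℕ x + toℕ i ≈ toℕ c → x ≡ c ⊖ i
  ⊖-unique {c} {i} x+i≈c = toℕ-≈-injective (+-cancelʳ-≈ (<⇒≤ (toℕ<n i)) (S.trans x+i≈c (S.sym (⊖-≈ c i))))
    where module S = Setoid ≈-setoid

  toℕ-⊖-≤ : ∀ {c i} → toℕ i ≤ toℕ c → toℕ (c ⊖ i) ≡ toℕ c ∸ toℕ i
  toℕ-⊖-≤ {c} {i} i≤c = ≈⇒≡ (toℕ<n (c ⊖ i)) (≤-<-trans (m∸n≤m (toℕ c) (toℕ i)) (toℕ<n c))
    (+-cancelʳ-≈ (<⇒≤ (toℕ<n i)) (S.trans (⊖-≈ c i) (≈-reflexive (sym (m∸n+n≡m i≤c)))))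
    where module S = Setoid ≈-setoid

  toℕ-⊖-> : ∀ {c i} → toℕ c < toℕ i → toℕ (c ⊖ i) ≡ toℕ c + n ∸ toℕ i
  toℕ-⊖-> {c} {i} c<i = trans (toℕ-⊖ c i) (trans (m<n⇒m%n≡m c+[n∸i]<n) (sym (+-∸-assoc (toℕ c) (<⇒≤ (toℕ<n i)))))
    where
    c+[n∸i]<n : toℕ c + (n ∸ toℕ i) < n
    c+[n∸i]<n = subst (toℕ c + (n ∸ toℕ i) <_) (m+[n∸m]≡n (<⇒≤ (toℕ<n i))) (+-monoˡ-< (n ∸ toℕ i) c<i)

  ⊖-involutive : ∀ c i → c ⊖ (c ⊖ i) ≡ i
  ⊖-involutive c i = sym (⊖-unique (S.trans (≈-reflexive (+-comm (toℕ i) (toℕ (c ⊖ i)))) (⊖-≈ c i)))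
    where module S = Setoid ≈-setoid

  toℕ-⊖-self : ∀ c → toℕ (c ⊖ c) ≡ 0
  toℕ-⊖-self c = trans (toℕ-⊖-≤ {c} {c} ≤-refl) (n∸n≡0 (toℕ c))

  addMod-⊖-addMod : ∀ k c i → addMod k (c ⊖ addMod k i) ≡ c ⊖ i
  addMod-⊖-addMod k c i = ⊖-unique (begin
    toℕ (addMod k d) + toℕ i       ≈⟨ +-≈ (addMod-≈ k d) (mod≡ refl) ⟩
    toℕ d + k + toℕ i              ≡⟨ +-assoc (toℕ d) k (toℕ i) ⟩
    toℕ d + (k + toℕ i)            ≡⟨ cong (toℕ d +_) (+-comm k (toℕ i)) ⟩
    toℕ d + (toℕ i + k)            ≈⟨ +-≈ (mod≡ refl) (Setoid.sym ≈-setoid (addMod-≈ k i)) ⟩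
    toℕ d + toℕ (addMod k i)       ≈⟨ ⊖-≈ c (addMod k i) ⟩
    toℕ c                          ∎)
    where
    open SetoidReasoning ≈-setoid
    d : Fin n
    d = c ⊖ addMod k i

  addMod-half-involutive : ∀ {a} → a + a ≡ n → ∀ i → addMod a (addMod a i) ≡ i
  addMod-half-involutive {a} a+a≡n i = toℕ-≈-injective (begin
    toℕ (addMod a (addMod a i))   ≈⟨ addMod-≈ a (addMod a i) ⟩
    toℕ (addMod a i) + a          ≈⟨ +-≈ (addMod-≈ a i) (mod≡ refl) ⟩
    toℕ i + a + a                 ≡⟨ trans (+-assoc (toℕ i) a a) (cong (toℕ i +_) a+a≡n) ⟩
    toℕ i + n                     ≈⟨ +n-≈ (toℕ i) ⟩
    toℕ i                         ∎)
    where open SetoidReasoning ≈-setoid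

  addMod-moves : ∀ {d} → 0 < d → d < n → ∀ i → addMod d i ≢ i
  addMod-moves {d} 0<d d<n i eq = <-irrefl (sym d≡0) 0<d
    where
    d+i≈0+i : d + toℕ i ≈ 0 + toℕ i
    d+i≈0+i = begin
      d + toℕ i             ≡⟨ +-comm d (toℕ i) ⟩
      toℕ i + d             ≈⟨ addMod-≈ d i ⟨
      toℕ (addMod d i)      ≡⟨ cong toℕ eq ⟩
      toℕ i                 ∎
      where open SetoidReasoning ≈-setoid
    d≡0 : d ≡ 0
    d≡0 = ≈⇒≡ d<n (≤-<-trans z≤n d<n) (+-cancelʳ-≈ (<⇒≤ (toℕ<n i)) d+i≈0+i)

module _ {k : ℕ} (f f′ : ℕ → Bool) where

  private
    lookup-f : ∀ (c : Fin k) → lookup (tabulate (f ∘ toℕ)) c ≡ f (toℕ c)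
    lookup-f = lookup∘tabulate (f ∘ toℕ)

    lookup-f′ : ∀ (c : Fin k) → lookup (tabulate (f′ ∘ toℕ)) c ≡ f′ (toℕ c)
    lookup-f′ = lookup∘tabulate (f′ ∘ toℕ)

  tabulate-differInExactlyOne : ∀ c₀ → c₀ < k → f c₀ ≢ f′ c₀ → (∀ c → c < k → c ≢ c₀ → f c ≡ f′ c) →
                                DifferInExactlyOne (tabulate {n = k} (f ∘ toℕ)) (tabulate (f′ ∘ toℕ))
  tabulate-differInExactlyOne c₀ c₀<k differs rest =
    fromℕ< c₀<k ,
    (λ eq → differs (subst (λ t → f t ≡ f′ t) (toℕ-fromℕ< c₀<k)
                      (trans (sym (lookup-f (fromℕ< c₀<k))) (trans eq (lookup-f′ (fromℕ< c₀<k)))))) ,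
    λ c c≢c₀ → trans (lookup-f c)
                 (trans (rest (toℕ c) (toℕ<n c) (λ eq → c≢c₀ (toℕ-injective (trans eq (sym (toℕ-fromℕ< c₀<k))))))
                        (sym (lookup-f′ c)))

  tabulate-differInAll : (∀ c → c < k → f c ≢ f′ c) → DifferInAll (tabulate {n = k} (f ∘ toℕ)) (tabulate (f′ ∘ toℕ))
  tabulate-differInAll differs c eq = differs (toℕ c) (toℕ<n c) (trans (sym (lookup-f c)) (trans eq (lookup-f′ c)))

  tabulate-≡⇒ : tabulate {n = k} (f ∘ toℕ) ≡ tabulate (f′ ∘ toℕ) → ∀ c → c < k → f c ≡ f′ c
  tabulate-≡⇒ f≡f′ c c<k = subst (λ t → f t ≡ f′ t) (toℕ-fromℕ< c<k)
    (trans (sym (lookup-f (fromℕ< c<k))) (trans (cong (λ v → lookup v (fromℕ< c<k)) f≡f′) (lookup-f′ (fromℕ< c<k))))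

-- (TT(g), J) is a subgraph of SPC(g − 1)

<?-suc : ∀ {c i} → c ≢ i → does (c <? suc i) ≡ does (c <? i)
<?-suc {c} {i} c≢i with <-cmp c i
... | tri< c<i _ _ = trans (dec-true (c <? suc i) (m<n⇒m<1+n c<i)) (sym (dec-true (c <? i) c<i))
... | tri≈ _ c≡i _ = ⊥-elim (c≢i c≡i)
... | tri> _ _ i<c = trans (dec-false (c <? suc i) (<⇒≱ i<c ∘ ≤-pred)) (sym (dec-false (c <? i) (<-asym i<c)))

module TTEmbedding (h : ℕ) where

  g a b n k : ℕ
  g = suc (suc h)
  a = aT g
  b = bT g
  n = 2 * a
  k = suc h

  a+b≡g : a + b ≡ g
  a+b≡g = ⌊n/2⌋+⌈n/2⌉≡n g

  n≡a+a : n ≡ a + a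
  n≡a+a = cong (a +_) (+-identityʳ a)

  1+i≤i+a : ∀ i → suc i ≤ i + a
  1+i≤i+a i = subst (_≤ i + a) (+-comm i 1) (+-monoʳ-≤ i (s≤s z≤n))

  upper-half : ∀ i → i < n → a ≤ i → i ∸ a < a
  upper-half i i<n a≤i = +-cancelʳ-< a _ a (subst (_< a + a) (sym (m∸n+n≡m a≤i)) (subst (i <_) n≡a+a i<n))

  arc : ℕ → ℕ → Bool
  arc c i = does (c <? i) ∧ does (i ≤? c + a)

  arc-inside : ∀ {c i} → c < i → i ≤ c + a → arc c i ≡ true
  arc-inside {c} {i} c<i i≤c+a = cong₂ _∧_ (dec-true (c <? i) c<i) (dec-true (i ≤? c + a) i≤c+a)

  arc-below : ∀ {c i} → i ≤ c → arc c i ≡ false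
  arc-below {c} {i} i≤c = cong (_∧ does (i ≤? c + a)) (dec-false (c <? i) (≤⇒≯ i≤c))

  arc-above : ∀ {c i} → c + a < i → arc c i ≡ false
  arc-above {c} {i} c+a<i = trans (cong (does (c <? i) ∧_) (dec-false (i ≤? c + a) (<⇒≱ c+a<i))) (∧-zeroʳ _)

  arc-suc : ∀ {c i} → c ≢ i → c + a ≢ i → arc c (suc i) ≡ arc c i
  arc-suc {c} {i} c≢i c+a≢i = cong₂ _∧_ (<?-suc c≢i) (≤?-suc)
    where
    ≤?-suc : does (suc i ≤? c + a) ≡ does (i ≤? c + a)
    ≤?-suc with i ≤? c + a
    ... | yes i≤c+a = trans (dec-true (suc i ≤? c + a) (≤∧≢⇒< i≤c+a (c+a≢i ∘ sym))) (sym (dec-true (i ≤? c + a) i≤c+a))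
    ... | no  i≰c+a = trans (dec-false (suc i ≤? c + a) (i≰c+a ∘ <⇒≤)) (sym (dec-false (i ≤? c + a) i≰c+a))

  arc-antipodal : ∀ {c i} → c < a → i < a → arc c (i + a) ≡ not (arc c i)
  arc-antipodal {c} {i} c<a i<a with c <? i
  ... | yes c<i = trans (arc-above (+-monoˡ-< a c<i)) (cong not (sym (arc-inside c<i (≤-trans (<⇒≤ i<a) (m≤n+m a c)))))
  ... | no  c≮i = trans (arc-inside (<-≤-trans c<a (m≤n+m a i)) (+-monoˡ-≤ a (≮⇒≥ c≮i))) (cong not (sym (arc-below (≮⇒≥ c≮i))))

  ArcsCrossOnce : ℕ → ℕ → Set
  ArcsCrossOnce i i′ = Σ ℕ λ c₀ → c₀ < a × arc c₀ i ≢ arc c₀ i′ × (∀ c → c < a → c ≢ c₀ → arc c i ≡ arc c i′)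

  arcs-suc-<a : ∀ {i} → i < a → ArcsCrossOnce i (suc i)
  arcs-suc-<a {i} i<a =
    i , i<a ,
    (λ eq → case trans (sym (arc-below {i} ≤-refl)) (trans eq (arc-inside (n<1+n i) (1+i≤i+a i))) of λ ()) ,
    λ c c<a c≢i → sym (arc-suc c≢i λ c+a≡i → <-irrefl (sym c+a≡i) (<-≤-trans i<a (m≤n+m a c)))

  arcs-suc-≥a : ∀ {i} → a ≤ i → i < n → ArcsCrossOnce i (suc i)
  arcs-suc-≥a {i} a≤i i<n =
    c₀ , c₀<a ,
    (λ eq → case trans (sym (arc-inside c₀<i (≤-reflexive (sym c₀+a≡i)))) (trans eq (arc-above (s≤s (≤-reflexive c₀+a≡i)))) of λ ()) ,
    λ c c<a c≢c₀ → sym (arc-suc (λ c≡i → <-irrefl c≡i (<-≤-trans c<a a≤i))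
                                (λ c+a≡i → c≢c₀ (trans (sym (m+n∸n≡m c a)) (cong (_∸ a) c+a≡i))))
    where
    c₀ : ℕ
    c₀ = i ∸ a
    c₀+a≡i : c₀ + a ≡ i
    c₀+a≡i = m∸n+n≡m a≤i
    c₀<a : c₀ < a
    c₀<a = upper-half i i<n a≤i
    c₀<i : c₀ < i
    c₀<i = subst (c₀ <_) c₀+a≡i (subst (_≤ c₀ + a) (+-comm c₀ 1) (+-monoʳ-≤ c₀ (s≤s z≤n)))

  arcs-last : ∀ {i} → suc i ≡ n → ArcsCrossOnce i 0
  arcs-last {i} i+1≡n =
    a′ , ≤-refl ,
    (λ eq → case trans (sym (arc-inside a′<i (≤-reflexive i≡a′+a))) (trans eq (arc-below {a′} z≤n)) of λ ()) ,
    λ c c<a c≢a′ → trans (arc-above (subst (c + a <_) (sym i≡a′+a) (+-monoˡ-< a (≤∧≢⇒< (≤-pred c<a) c≢a′))))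
                          (sym (arc-below {c} z≤n))
    where
    a′ : ℕ
    a′ = ⌊ h /2⌋
    i≡a′+a : i ≡ a′ + a
    i≡a′+a = suc-injective (trans i+1≡n n≡a+a)
    a′<i : a′ < i
    a′<i = subst (a′ <_) (sym i≡a′+a) (1+i≤i+a a′)

  arcs-csuc : ∀ (i : Fin n) → ArcsCrossOnce (toℕ i) (toℕ (csuc i))
  arcs-csuc i = cases (suc (toℕ i) <? n) (toℕ i <? a)
    where
    cases : Dec (suc (toℕ i) < n) → Dec (toℕ i < a) → ArcsCrossOnce (toℕ i) (toℕ (csuc i))
    cases (yes i+1<n) (yes i<a) = subst (ArcsCrossOnce (toℕ i)) (sym (toℕ-csuc-< i i+1<n)) (arcs-suc-<a i<a)
    cases (yes i+1<n) (no  i≮a) = subst (ArcsCrossOnce (toℕ i)) (sym (toℕ-csuc-< i i+1<n)) (arcs-suc-≥a (≮⇒≥ i≮a) (toℕ<n i))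
    cases (no  i+1≮n) _         = subst (ArcsCrossOnce (toℕ i)) (sym (cong toℕ (csuc-last i i+1≡n))) (arcs-last i+1≡n)
      where
      i+1≡n : suc (toℕ i) ≡ n
      i+1≡n = ≤-antisym (toℕ<n i) (≮⇒≥ i+1≮n)

  open Modular n using (≈⇒≡; addMod-≈; +n-≈; ≈-setoid)

  toℕ-addMod-< : ∀ (i : Fin n) → toℕ i < a → toℕ (addMod a i) ≡ toℕ i + a
  toℕ-addMod-< i i<a = ≈⇒≡ (toℕ<n (addMod a i)) (subst (toℕ i + a <_) (sym n≡a+a) (+-monoˡ-< a i<a)) (addMod-≈ a i)

  toℕ-addMod-≥ : ∀ (i : Fin n) → a ≤ toℕ i → toℕ (addMod a i) + a ≡ toℕ i
  toℕ-addMod-≥ i a≤i = trans (cong (_+ a) addMod≡) (m∸n+n≡m a≤i)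
    where
    open SetoidReasoning ≈-setoid
    i∸a<n : toℕ i ∸ a < n
    i∸a<n = ≤-<-trans (m∸n≤m (toℕ i) a) (toℕ<n i)
    addMod≡ : toℕ (addMod a i) ≡ toℕ i ∸ a
    addMod≡ = ≈⇒≡ (toℕ<n (addMod a i)) i∸a<n (begin
      toℕ (addMod a i)         ≈⟨ addMod-≈ a i ⟩
      toℕ i + a                ≡⟨ cong (_+ a) (m∸n+n≡m a≤i) ⟨
      toℕ i ∸ a + a + a        ≡⟨ trans (+-assoc (toℕ i ∸ a) a a) (cong (toℕ i ∸ a +_) (sym n≡a+a)) ⟩
      toℕ i ∸ a + n            ≈⟨ +n-≈ (toℕ i ∸ a) ⟩
      toℕ i ∸ a                ∎)

  arcs-antipodal : ∀ (i : Fin n) {c} → c < a → arc c (toℕ i) ≢ arc c (toℕ (addMod a i))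
  arcs-antipodal i {c} c<a with toℕ i <? a
  ... | yes i<a = λ eq → not-¬ refl (trans eq (trans (cong (arc c) (toℕ-addMod-< i i<a)) (arc-antipodal c<a i<a)))
  ... | no  i≮a = λ eq → not-¬ refl (trans (sym eq) (trans (cong (arc c) (sym (toℕ-addMod-≥ i (≮⇒≥ i≮a)))) (arc-antipodal c<a i′<a)))
    where
    i′<a : toℕ (addMod a i) < a
    i′<a = +-cancelʳ-< a _ a (subst (_< a + a) (sym (toℕ-addMod-≥ i (≮⇒≥ i≮a))) (subst (toℕ i <_) n≡a+a (toℕ<n i)))

  arcs-separate : ∀ {i i′} → i < i′ → i′ < n → Σ ℕ λ c → c < a × arc c i ≢ arc c i′
  arcs-separate {i} {i′} i<i′ i′<n with i′ ≤? a | a <? i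
  ... | yes i′≤a | _       =
    i , <-≤-trans i<i′ i′≤a ,
    λ eq → case trans (sym (arc-below {i} ≤-refl)) (trans eq (arc-inside i<i′ (≤-trans i′≤a (m≤n+m a i)))) of λ ()
  ... | no  i′≰a | yes a<i =
    i ∸ a , upper-half i (<-trans i<i′ i′<n) (<⇒≤ a<i) ,
    λ eq → case trans (sym (arc-inside (∸-monoʳ-< {i} {a} {0} (s≤s z≤n) (<⇒≤ a<i)) (≤-reflexive (sym (m∸n+n≡m (<⇒≤ a<i))))))
                      (trans eq (arc-above (subst (_< i′) (sym (m∸n+n≡m (<⇒≤ a<i))) i<i′))) of λ ()
  ... | no  i′≰a | no  a≮i = straddling i i<i′ (≮⇒≥ a≮i)
    where
    a<i′ : a < i′
    a<i′ = ≰⇒> i′≰a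
    straddling : ∀ i → i < i′ → i ≤ a → Σ ℕ λ c → c < a × arc c i ≢ arc c i′
    straddling zero _ _ =
      i′ ∸ a , upper-half i′ i′<n (<⇒≤ a<i′) ,
      λ eq → case trans (sym (arc-below {i′ ∸ a} z≤n))
                        (trans eq (arc-inside (∸-monoʳ-< {i′} {a} {0} (s≤s z≤n) (<⇒≤ a<i′)) (≤-reflexive (sym (m∸n+n≡m (<⇒≤ a<i′)))))) of λ ()
    straddling (suc i₀) _ i≤a =
      0 , s≤s z≤n ,
      λ eq → case trans (sym (arc-inside (s≤s z≤n) i≤a)) (trans eq (arc-above a<i′)) of λ ()

  coord : ℕ → VTT g → Bool
  coord c (i , j) = if does (c <? a) then arc c (toℕ i) else does (c ∸ a <? toℕ j)

  coord-arc : ∀ {c} → c < a → ∀ i j → coord c (i , j) ≡ arc c (toℕ i)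
  coord-arc {c} c<a i j = cong (if_then arc c (toℕ i) else does (c ∸ a <? toℕ j)) (dec-true (c <? a) c<a)

  coord-row : ∀ {c} → a ≤ c → ∀ i j → coord c (i , j) ≡ does (c ∸ a <? toℕ j)
  coord-row {c} a≤c i j = cong (if_then arc c (toℕ i) else does (c ∸ a <? toℕ j)) (dec-false (c <? a) (≤⇒≯ a≤c))

  coord-a+ : ∀ d i j → coord (a + d) (i , j) ≡ does (d <? toℕ j)
  coord-a+ d i j = trans (coord-row (m≤m+n a d) i j) (cong (λ t → does (t <? toℕ j)) (m+n∸m≡n a d))

  φ : VTT g → Vec Bool k
  φ v = tabulate (λ c → coord (toℕ c) v)

  a+j<k : ∀ {j j′} → j < j′ → j′ < b → a + j < k
  a+j<k {j′ = j′} j<j′ j′<b = <-≤-trans (+-monoʳ-< a j<j′) (≤-pred (subst (a + j′ <_) a+b≡g (+-monoʳ-< a j′<b)))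

  a≤k : a ≤ k
  a≤k = ≤-pred (subst (a <_) a+b≡g (subst (_≤ a + b) (+-comm a 1) (+-monoʳ-≤ a (s≤s z≤n))))

  thermometer-differs : ∀ {d j} → d < j → does (d <? d) ≢ does (d <? j)
  thermometer-differs {d} {j} d<j eq = case trans (sym (dec-false (d <? d) (<-irrefl refl))) (trans eq (dec-true (d <? j) d<j)) of λ ()

  φ-injective : ∀ u v → φ u ≡ φ v → u ≡ v
  φ-injective (i , j) (i′ , j′) φu≡φv = cong₂ _,_ (toℕ-injective columns) (toℕ-injective rows)
    where
    same : ∀ c → c < k → coord c (i , j) ≡ coord c (i′ , j′)
    same = tabulate-≡⇒ (λ c → coord c (i , j)) (λ c → coord c (i′ , j′)) φu≡φv
    same-arc : ∀ {c} → c < a → arc c (toℕ i) ≡ arc c (toℕ i′)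
    same-arc c<a = trans (sym (coord-arc c<a i j)) (trans (same _ (<-≤-trans c<a a≤k)) (coord-arc c<a i′ j′))
    same-row : ∀ d → a + d < k → does (d <? toℕ j) ≡ does (d <? toℕ j′)
    same-row d a+d<k = trans (sym (coord-a+ d i j)) (trans (same (a + d) a+d<k) (coord-a+ d i′ j′))
    columns : toℕ i ≡ toℕ i′
    columns with <-cmp (toℕ i) (toℕ i′)
    ... | tri≈ _ i≡i′ _ = i≡i′
    ... | tri< i<i′ _ _ = let (c , c<a , differs) = arcs-separate i<i′ (toℕ<n i′) in ⊥-elim (differs (same-arc c<a))
    ... | tri> _ _ i′<i = let (c , c<a , differs) = arcs-separate i′<i (toℕ<n i) in ⊥-elim (differs (sym (same-arc c<a)))
    rows : toℕ j ≡ toℕ j′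
    rows with <-cmp (toℕ j) (toℕ j′)
    ... | tri≈ _ j≡j′ _ = j≡j′
    ... | tri< j<j′ _ _ = ⊥-elim (thermometer-differs j<j′ (same-row (toℕ j) (a+j<k j<j′ (toℕ<n j′))))
    ... | tri> _ _ j′<j = ⊥-elim (thermometer-differs j′<j (sym (same-row (toℕ j′) (a+j<k j′<j (toℕ<n j)))))

  vertical-differInExactlyOne : ∀ i (j j′ : Fin b) → suc (toℕ j) ≡ toℕ j′ → DifferInExactlyOne (φ (i , j)) (φ (i , j′))
  vertical-differInExactlyOne i j j′ j+1≡j′ =
    tabulate-differInExactlyOne (λ c → coord c (i , j)) (λ c → coord c (i , j′)) (a + toℕ j)
      (a+j<k j<j′ (toℕ<n j′))
      (λ eq → thermometer-differs j<j′ (trans (sym (coord-a+ (toℕ j) i j)) (trans eq (coord-a+ (toℕ j) i j′))))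
      rest
    where
    j<j′ : toℕ j < toℕ j′
    j<j′ = ≤-reflexive j+1≡j′
    rest : ∀ c → c < k → c ≢ a + toℕ j → coord c (i , j) ≡ coord c (i , j′)
    rest c _ c≢a+j with c <? a
    ... | yes c<a = trans (coord-arc c<a i j) (sym (coord-arc c<a i j′))
    ... | no  c≮a = trans (coord-row (≮⇒≥ c≮a) i j)
                     (trans (sym (trans (cong (λ t → does (c ∸ a <? t)) (sym j+1≡j′)) (<?-suc c∸a≢j)))
                            (sym (coord-row (≮⇒≥ c≮a) i j′)))
      where
      c∸a≢j : c ∸ a ≢ toℕ j
      c∸a≢j eq = c≢a+j (trans (sym (m∸n+n≡m (≮⇒≥ c≮a))) (trans (cong (_+ a) eq) (+-comm (toℕ j) a)))

  horizontal-differInExactlyOne : ∀ (i : Fin n) j → DifferInExactlyOne (φ (i , j)) (φ (csuc i , j))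
  horizontal-differInExactlyOne i j with arcs-csuc i
  ... | c₀ , c₀<a , differs , rest =
    tabulate-differInExactlyOne (λ c → coord c (i , j)) (λ c → coord c (csuc i , j)) c₀ (<-≤-trans c₀<a a≤k)
      (λ eq → differs (trans (sym (coord-arc c₀<a i j)) (trans eq (coord-arc c₀<a (csuc i) j))))
      rest′
    where
    rest′ : ∀ c → c < k → c ≢ c₀ → coord c (i , j) ≡ coord c (csuc i , j)
    rest′ c _ c≢c₀ with c <? a
    ... | yes c<a = trans (coord-arc c<a i j) (trans (rest c c<a c≢c₀) (sym (coord-arc c<a (csuc i) j)))
    ... | no  c≮a = trans (coord-row (≮⇒≥ c≮a) i j) (sym (coord-row (≮⇒≥ c≮a) (csuc i) j))

  jump-differInAll : ∀ (i : Fin n) (w : Fin b) → suc (toℕ w) ≡ b → DifferInAll (φ (i , zero)) (φ (addMod a i , w))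
  jump-differInAll i w w+1≡b = tabulate-differInAll (λ c → coord c (i , zero)) (λ c → coord c (addMod a i , w)) differs
    where
    k≡a+w : k ≡ a + toℕ w
    k≡a+w = suc-injective (trans (sym a+b≡g) (trans (cong (a +_) (sym w+1≡b)) (+-suc a (toℕ w))))
    differs : ∀ c → c < k → coord c (i , zero) ≢ coord c (addMod a i , w)
    differs c c<k with c <? a
    ... | yes c<a = λ eq → arcs-antipodal i c<a (trans (sym (coord-arc c<a i zero)) (trans eq (coord-arc c<a (addMod a i) w)))
    ... | no  c≮a = λ eq → case trans (sym (dec-false (c ∸ a <? 0) λ ()))
                                  (trans (sym (coord-row (≮⇒≥ c≮a) i zero))
                                  (trans eq (trans (coord-row (≮⇒≥ c≮a) (addMod a i) w) (dec-true (c ∸ a <? toℕ w) c∸a<w)))) of λ ()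
      where
      c∸a<w : c ∸ a < toℕ w
      c∸a<w = +-cancelʳ-< a _ (toℕ w) (subst₂ _<_ (sym (m∸n+n≡m (≮⇒≥ c≮a))) (trans k≡a+w (+-comm a (toℕ w))) c<k)

  TT-subgraphOfSPC : SubgraphOfSPC (TTJ g) (g ∸ 1)
  TT-subgraphOfSPC = φ , φ-injective , positive , negative
    where
    positive : ∀ e → negTT e ≡ false → DifferInExactlyOne (φ (e₁TT e)) (φ (e₂TT e))
    positive (vert i j j′ p) _ = vertical-differInExactlyOne i j j′ (≡ᵇ⇒≡ (suc (toℕ j)) (toℕ j′) p)
    positive (horiz i j _)   _ = horizontal-differInExactlyOne i j
    negative : ∀ e → negTT e ≡ true → DifferInAll (φ (e₁TT e)) (φ (e₂TT e))
    negative (jump i zero w _ q _) _ = jump-differInAll i w (≡ᵇ⇒≡ (suc (toℕ w)) b q)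

-- Symmetries and negative g-cycles of (TT(g), J)

module _ {G : SGraph} where
  open SGraph G

  signPreservingInvolution : (φ : V → V) (ψ : E → E) → (∀ x → φ (φ x) ≡ x) → (∀ e → ψ (ψ e) ≡ e) →
                             (∀ e → Joins G (ψ e) (φ (end₁ e)) (φ (end₂ e))) → (∀ e → neg (ψ e) ≡ neg e) →
                             SwitchingInvolution G
  signPreservingInvolution φ ψ φφ ψψ joins sign = record
    { φ = φ ; ψ = ψ ; φ-involutive = φφ ; ψ-involutive = ψψ ; ψ-joins = joins
    ; switch = λ _ → false ; neg-ψ = λ e → trans (sign e) (sym (xor-identityʳ (neg e))) }

  identityInvolution : SwitchingInvolution G
  identityInvolution =
    signPreservingInvolution (λ x → x) (λ e → e) (λ _ → refl) (λ _ → refl) (λ _ → inj₁ (refl , refl)) (λ _ → refl)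

module TT2 where

  o : VTT 2
  o = zero , zero

  swap : SwitchingInvolution (TTJ 2)
  swap = signPreservingInvolution φ (λ e → e) φφ (λ _ → refl) joins (λ _ → refl)
    where
    φ : VTT 2 → VTT 2
    φ (zero     , j) = suc zero , j
    φ (suc zero , j) = zero , j
    φφ : ∀ x → φ (φ x) ≡ x
    φφ (zero     , j) = refl
    φφ (suc zero , j) = refl
    joins : ∀ e → Joins (TTJ 2) e (φ (e₁TT e)) (φ (e₂TT e))
    joins (vert _ zero zero ())
    joins (horiz zero zero _)         = inj₂ (refl , refl)
    joins (jump zero zero zero _ _ _) = inj₂ (refl , refl)

  toBase : ToBase o
  toBase (zero     , zero) = identityInvolution , refl
  toBase (suc zero , zero) = swap , refl

  digon : Walk (TTJ 2) o o
  digon = step (horiz zero zero _) (inj₁ (refl , refl)) (step (jump zero zero zero _ _ _) (inj₂ (refl , refl)) [])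

  cycle : ∀ w → NegCycleThrough 2 (TTJ 2) o w
  cycle w = o , digon , (s≤s z≤n , ((λ ()) ∷ []) ∷ [] ∷ [] , ((λ ()) ∷ []) ∷ [] ∷ []) , refl , refl , here refl , visits-all w
    where
    visits-all : ∀ w → w ∈ verts digon
    visits-all (zero     , zero) = here refl
    visits-all (suc zero , zero) = there (here refl)

module TT3 where

  o : VTT 3
  o = zero , zero

  flip : Fin 2 → Fin 2
  flip zero       = suc zero
  flip (suc zero) = zero

  flip-involutive : ∀ i → flip (flip i) ≡ i
  flip-involutive zero       = refl
  flip-involutive (suc zero) = refl

  swapColumns : SwitchingInvolution (TTJ 3)
  swapColumns = signPreservingInvolution φ ψ φφ ψψ joins sign
    where
    φ : VTT 3 → VTT 3
    φ (i , j) = flip i , j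
    φφ : ∀ x → φ (φ x) ≡ x
    φφ (i , j) = cong (_, j) (flip-involutive i)
    ψ : ETT 3 → ETT 3
    ψ (vert i j j′ p)    = vert (flip i) j j′ p
    ψ (horiz i j p)      = horiz i j p
    ψ (jump i z w p q r) = jump (flip i) z w p q r
    ψψ : ∀ e → ψ (ψ e) ≡ e
    ψψ (vert i j j′ p)    = cong (λ t → vert t j j′ p) (flip-involutive i)
    ψψ (horiz i j p)      = refl
    ψψ (jump i z w p q r) = cong (λ t → jump t z w p q r) (flip-involutive i)
    joins : ∀ e → Joins (TTJ 3) (ψ e) (φ (e₁TT e)) (φ (e₂TT e))
    joins (vert zero j j′ p)                        = inj₁ (refl , refl)
    joins (vert (suc zero) j j′ p)                  = inj₁ (refl , refl)
    joins (horiz zero zero p)                       = inj₂ (refl , refl)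
    joins (horiz zero (suc zero) p)                 = inj₂ (refl , refl)
    joins (jump zero zero (suc zero) p q r)         = inj₁ (refl , refl)
    joins (jump (suc zero) zero (suc zero) p q r)   = inj₁ (refl , refl)
    sign : ∀ e → negTT (ψ e) ≡ negTT e
    sign (vert _ _ _ _)       = refl
    sign (horiz _ _ _)        = refl
    sign (jump _ _ _ _ _ _)   = refl

  flipRows : SwitchingInvolution (TTJ 3)
  flipRows = signPreservingInvolution φ ψ φφ ψψ joins sign
    where
    φ : VTT 3 → VTT 3
    φ (i , j) = i , flip j
    φφ : ∀ x → φ (φ x) ≡ x
    φφ (i , j) = cong (i ,_) (flip-involutive j)
    ψ : ETT 3 → ETT 3
    ψ (vert i j j′ p)    = vert i j j′ p
    ψ (horiz i j p)      = horiz i (flip j) p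
    ψ (jump i z w p q r) = jump (flip i) z w p q r
    ψψ : ∀ e → ψ (ψ e) ≡ e
    ψψ (vert i j j′ p)    = refl
    ψψ (horiz i j p)      = cong (λ t → horiz i t p) (flip-involutive j)
    ψψ (jump i z w p q r) = cong (λ t → jump t z w p q r) (flip-involutive i)
    joins : ∀ e → Joins (TTJ 3) (ψ e) (φ (e₁TT e)) (φ (e₂TT e))
    joins (vert i zero (suc zero) p)                = inj₂ (refl , refl)
    joins (horiz zero zero p)                       = inj₁ (refl , refl)
    joins (horiz zero (suc zero) p)                 = inj₁ (refl , refl)
    joins (jump zero zero (suc zero) p q r)         = inj₂ (refl , refl)
    joins (jump (suc zero) zero (suc zero) p q r)   = inj₂ (refl , refl)
    sign : ∀ e → negTT (ψ e) ≡ negTT e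
    sign (vert _ _ _ _)       = refl
    sign (horiz _ _ _)        = refl
    sign (jump _ _ _ _ _ _)   = refl

  swapBoth : SwitchingInvolution (TTJ 3)
  swapBoth = signPreservingInvolution φ ψ φφ ψψ joins sign
    where
    φ : VTT 3 → VTT 3
    φ (i , j) = flip i , flip j
    φφ : ∀ x → φ (φ x) ≡ x
    φφ (i , j) = cong₂ _,_ (flip-involutive i) (flip-involutive j)
    ψ : ETT 3 → ETT 3
    ψ (vert i j j′ p)    = vert (flip i) j j′ p
    ψ (horiz i j p)      = horiz i (flip j) p
    ψ (jump i z w p q r) = jump i z w p q r
    ψψ : ∀ e → ψ (ψ e) ≡ e
    ψψ (vert i j j′ p)    = cong (λ t → vert t j j′ p) (flip-involutive i)
    ψψ (horiz i j p)      = cong (λ t → horiz i t p) (flip-involutive j)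
    ψψ (jump i z w p q r) = refl
    joins : ∀ e → Joins (TTJ 3) (ψ e) (φ (e₁TT e)) (φ (e₂TT e))
    joins (vert zero zero (suc zero) p)             = inj₂ (refl , refl)
    joins (vert (suc zero) zero (suc zero) p)       = inj₂ (refl , refl)
    joins (horiz zero zero p)                       = inj₂ (refl , refl)
    joins (horiz zero (suc zero) p)                 = inj₂ (refl , refl)
    joins (jump zero zero (suc zero) p q r)         = inj₂ (refl , refl)
    joins (jump (suc zero) zero (suc zero) p q r)   = inj₂ (refl , refl)
    sign : ∀ e → negTT (ψ e) ≡ negTT e
    sign (vert _ _ _ _)       = refl
    sign (horiz _ _ _)        = refl
    sign (jump _ _ _ _ _ _)   = refl

  toBase : ToBase o
  toBase (zero     , zero)     = identityInvolution , refl
  toBase (suc zero , zero)     = swapColumns , refl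
  toBase (zero     , suc zero) = flipRows , refl
  toBase (suc zero , suc zero) = swapBoth , refl

  triangle₁ triangle₂ : Walk (TTJ 3) o o
  triangle₁ = step (vert zero zero (suc zero) _) (inj₁ (refl , refl))
                (step (jump (suc zero) zero (suc zero) _ _ _) (inj₂ (refl , refl))
                (step (horiz zero zero _) (inj₂ (refl , refl)) []))
  triangle₂ = step (jump zero zero (suc zero) _ _ _) (inj₁ (refl , refl))
                (step (vert (suc zero) zero (suc zero) _) (inj₂ (refl , refl))
                (step (horiz zero zero _) (inj₂ (refl , refl)) []))

  triangle₁-isCycle : IsCycle (TTJ 3) triangle₁
  triangle₁-isCycle = s≤s z≤n , ((λ ()) ∷ (λ ()) ∷ []) ∷ ((λ ()) ∷ []) ∷ [] ∷ [] , ((λ ()) ∷ (λ ()) ∷ []) ∷ ((λ ()) ∷ []) ∷ [] ∷ []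

  triangle₂-isCycle : IsCycle (TTJ 3) triangle₂
  triangle₂-isCycle = s≤s z≤n , ((λ ()) ∷ (λ ()) ∷ []) ∷ ((λ ()) ∷ []) ∷ [] ∷ [] , ((λ ()) ∷ (λ ()) ∷ []) ∷ ((λ ()) ∷ []) ∷ [] ∷ []

  cycle : ∀ w → NegCycleThrough 3 (TTJ 3) o w
  cycle (zero     , zero)     = o , triangle₁ , triangle₁-isCycle , refl , refl , here refl , here refl
  cycle (zero     , suc zero) = o , triangle₁ , triangle₁-isCycle , refl , refl , here refl , there (here refl)
  cycle (suc zero , zero)     = o , triangle₁ , triangle₁-isCycle , refl , refl , here refl , there (there (here refl))
  cycle (suc zero , suc zero) = o , triangle₂ , triangle₂-isCycle , refl , refl , here refl , there (here refl)

T-irrelevant : ∀ {t} (p q : T t) → p ≡ q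
T-irrelevant {true} _ _ = refl

module TTLarge (h : ℕ) where

  open TTEmbedding (suc (suc h)) using (g; a; b; n; a+b≡g; n≡a+a; 1+i≤i+a; toℕ-addMod-<)

  G : SGraph
  G = TTJ g

  a<n : a < n
  a<n = subst (a <_) (sym n≡a+a) (1+i≤i+a a)

  open Modular n using (_⊖_; ⊖-involutive; toℕ-⊖-self; toℕ-⊖->; addMod-⊖-addMod; addMod-half-involutive; addMod-moves)
  open Modular b using ()
    renaming (_⊖_ to _⊖ʳ_; toℕ-⊖-≤ to toℕ-⊖ʳ-≤; toℕ-⊖-> to toℕ-⊖ʳ->; ⊖-involutive to ⊖ʳ-involutive; toℕ-⊖-self to toℕ-⊖ʳ-self)

  last : Fin b
  last = fromℕ (suc ⌈ h /2⌉)

  toℕ-last : toℕ last ≡ suc ⌈ h /2⌉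
  toℕ-last = Fin.toℕ-fromℕ _

  last-isLast : T (suc (toℕ last) ≡ᵇ b)
  last-isLast = ≡⇒≡ᵇ (suc (toℕ last)) b (cong suc toℕ-last)

  isLast⇒≡last : ∀ (w : Fin b) → T (suc (toℕ w) ≡ᵇ b) → w ≡ last
  isLast⇒≡last w q = toℕ-injective (trans (suc-injective (≡ᵇ⇒≡ (suc (toℕ w)) b q)) (sym toℕ-last))

  isFirst⇒≡zero : ∀ (z : Fin b) → T (toℕ z ≡ᵇ 0) → z ≡ zero
  isFirst⇒≡zero zero _ = refl

  last≢zero : ∀ (w : Fin b) → T (suc (toℕ w) ≡ᵇ b) → w ≢ zero
  last≢zero w q w≡0 = case trans (sym (cong toℕ w≡0)) (cong toℕ (isLast⇒≡last w q)) of λ ()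

  above⇒≢ : ∀ (j j′ : Fin b) → T (suc (toℕ j) ≡ᵇ toℕ j′) → j′ ≢ j
  above⇒≢ j j′ p j′≡j = 1+n≢n (trans (≡ᵇ⇒≡ (suc (toℕ j)) (toℕ j′) p) (cong toℕ j′≡j))

  above⇒≢first : ∀ (j j′ : Fin b) → T (suc (toℕ j) ≡ᵇ toℕ j′) → ¬ T (toℕ j′ ≡ᵇ 0)
  above⇒≢first j j′ p = subst (λ t → ¬ T (t ≡ᵇ 0)) (≡ᵇ⇒≡ (suc (toℕ j)) (toℕ j′) p) λ ()

  csuc-fromℕ< : ∀ (i : Fin n) (p : suc (toℕ i) < n) → csuc i ≡ fromℕ< p
  csuc-fromℕ< i p = toℕ-injective (trans (toℕ-csuc-< i p) (sym (toℕ-fromℕ< p)))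

  half-turn-moves : ∀ i → addMod a i ≢ i
  half-turn-moves = addMod-moves (s≤s z≤n) a<n

  two-steps-move : ∀ i → csuc (csuc i) ≢ i
  two-steps-move = addMod-moves {2} (s≤s z≤n) (subst (2 <_) (sym n≡a+a) (+-mono-≤ {2} {a} {1} {a} (s≤s (s≤s z≤n)) (s≤s z≤n)))

  edge-determined : ∀ e f → Joins G f (e₁TT e) (e₂TT e) → e ≡ f
  edge-determined (vert i j j′ p) (vert .i .j .j′ p′) (inj₁ (refl , refl)) = cong (vert i j j′) (T-irrelevant p p′)
  edge-determined (vert i j j′ p) (vert .i .j′ .j p′) (inj₂ (refl , refl)) =
    ⊥-elim (<-asym (≤-reflexive (≡ᵇ⇒≡ (suc (toℕ j)) (toℕ j′) p)) (≤-reflexive (≡ᵇ⇒≡ (suc (toℕ j′)) (toℕ j) p′)))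
  edge-determined (vert i j j′ p) (horiz .i .j _) (inj₁ (refl , eq)) = ⊥-elim (above⇒≢ j j′ p (sym (,-injectiveʳ eq)))
  edge-determined (vert i j j′ p) (horiz .i .j′ _) (inj₂ (refl , eq)) = ⊥-elim (above⇒≢ j j′ p (,-injectiveʳ eq))
  edge-determined (vert i j j′ p) (jump .i .j w _ _ _) (inj₁ (refl , eq)) = ⊥-elim (half-turn-moves i (,-injectiveˡ eq))
  edge-determined (vert i j j′ p) (jump .i .j′ w z _ _) (inj₂ (refl , eq)) = ⊥-elim (above⇒≢first j j′ p z)
  edge-determined (horiz i j p) (vert .i .j j′ p′) (inj₁ (refl , eq)) = ⊥-elim (above⇒≢ j j′ p′ (,-injectiveʳ eq))
  edge-determined (horiz i j p) (vert .(csuc i) .j j′ p′) (inj₂ (refl , eq)) = ⊥-elim (above⇒≢ j j′ p′ (,-injectiveʳ eq))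
  edge-determined (horiz i j p) (horiz .i .j p′) (inj₁ (refl , refl)) = cong (horiz i j) (T-irrelevant p p′)
  edge-determined (horiz i j p) (horiz .(csuc i) .j p′) (inj₂ (refl , eq)) = ⊥-elim (two-steps-move i (,-injectiveˡ eq))
  edge-determined (horiz i j p) (jump .i .j w z q _) (inj₁ (refl , eq)) =
    ⊥-elim (last≢zero w q (trans (,-injectiveʳ eq) (isFirst⇒≡zero j z)))
  edge-determined (horiz i j p) (jump .(csuc i) .j w z q _) (inj₂ (refl , eq)) =
    ⊥-elim (last≢zero w q (trans (,-injectiveʳ eq) (isFirst⇒≡zero j z)))
  edge-determined (jump i z w p q r) (vert .i .z j′ p′) (inj₁ (refl , eq)) = ⊥-elim (half-turn-moves i (sym (,-injectiveˡ eq)))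
  edge-determined (jump i z w p q r) (vert .(addMod a i) .w j′ p′) (inj₂ (refl , eq)) =
    ⊥-elim (above⇒≢first w j′ p′ (subst (λ t → T (toℕ t ≡ᵇ 0)) (sym (,-injectiveʳ eq)) p))
  edge-determined (jump i z w p q r) (horiz .i .z _) (inj₁ (refl , eq)) =
    ⊥-elim (last≢zero w q (trans (sym (,-injectiveʳ eq)) (isFirst⇒≡zero z p)))
  edge-determined (jump i z w p q r) (horiz .(addMod a i) .w _) (inj₂ (refl , eq)) =
    ⊥-elim (last≢zero w q (trans (,-injectiveʳ eq) (isFirst⇒≡zero z p)))
  edge-determined (jump i z w p q r) (jump .i .z .w p′ q′ r′) (inj₁ (refl , refl)) =
    trans (cong₂ (λ x y → jump i z w x y r) (T-irrelevant p p′) (T-irrelevant q q′)) (cong (jump i z w p′ q′) (T-irrelevant r r′))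
  edge-determined (jump i z w p q r) (jump .(addMod a i) .w w′ p′ q′ r′) (inj₂ (refl , eq)) =
    ⊥-elim (last≢zero w q (isFirst⇒≡zero w p′))

  TT-noParallelEdges : NoParallelEdges {G = G}
  TT-noParallelEdges {e} {f} (inj₁ (refl , refl)) J = edge-determined e f J
  TT-noParallelEdges {e} {f} (inj₂ (refl , refl)) J = edge-determined e f (Joins-sym {G = G} J)

  -- Rows are reflected in ℤ_b; a vertex above row c₂ is reflected across the seam between rows
  -- b−1 and 0, which costs a half-turn of the columns.
  module PointReflection (c₁ : Fin n) (c₂ : Fin b) where

    above : Fin b → Bool
    above j = does (toℕ c₂ <? toℕ j)

    above-≤ : ∀ {j} → toℕ j ≤ toℕ c₂ → above j ≡ false
    above-≤ {j} j≤c₂ = dec-false (toℕ c₂ <? toℕ j) (≤⇒≯ j≤c₂)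

    above-> : ∀ {j} → toℕ c₂ < toℕ j → above j ≡ true
    above-> {j} c₂<j = dec-true (toℕ c₂ <? toℕ j) c₂<j

    above-zero : above zero ≡ false
    above-zero = above-≤ {zero} z≤n

    above-⊖ʳ : ∀ j → above (c₂ ⊖ʳ j) ≡ above j
    above-⊖ʳ j with toℕ j ≤? toℕ c₂
    ... | yes j≤c₂ = trans (above-≤ (subst (_≤ toℕ c₂) (sym (toℕ-⊖ʳ-≤ j≤c₂)) (m∸n≤m (toℕ c₂) (toℕ j)))) (sym (above-≤ j≤c₂))
    ... | no  j≰c₂ = trans (above-> (subst (toℕ c₂ <_) (sym (toℕ-⊖ʳ-> (≰⇒> j≰c₂))) c₂<c₂+b∸j)) (sym (above-> (≰⇒> j≰c₂)))
      where
      c₂<c₂+b∸j : toℕ c₂ < toℕ c₂ + b ∸ toℕ j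
      c₂<c₂+b∸j = subst (toℕ c₂ <_) (sym (+-∸-assoc (toℕ c₂) (<⇒≤ (toℕ<n j))))
                    (subst (_≤ toℕ c₂ + (b ∸ toℕ j)) (+-comm (toℕ c₂) 1) (+-monoʳ-≤ (toℕ c₂) (m<n⇒0<n∸m (toℕ<n j))))

    shift : Bool → Fin n → Fin n
    shift f x = if f then addMod a x else x

    φ : VTT g → VTT g
    φ (i , j) = shift (above j) (c₁ ⊖ i) , c₂ ⊖ʳ j

    switch : VTT g → Bool
    switch (i , j) = above j

    φ-involutive : ∀ x → φ (φ x) ≡ x
    φ-involutive (i , j) = cong₂ _,_ (trans (cong (λ f → shift f (c₁ ⊖ shift (above j) (c₁ ⊖ i))) (above-⊖ʳ j)) (shift-back (above j)))
                                     (⊖ʳ-involutive c₂ j)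
      where
      shift-back : ∀ f → shift f (c₁ ⊖ shift f (c₁ ⊖ i)) ≡ i
      shift-back false = ⊖-involutive c₁ i
      shift-back true  = trans (addMod-⊖-addMod a c₁ (c₁ ⊖ i)) (⊖-involutive c₁ i)

    φ-c : φ (c₁ , c₂) ≡ (zero , zero)
    φ-c = cong₂ _,_ (trans (cong (λ f → shift f (c₁ ⊖ c₁)) (above-≤ {c₂} ≤-refl)) (toℕ-injective (toℕ-⊖-self c₁)))
                    (toℕ-injective (toℕ-⊖ʳ-self c₂))

    csuc-shift : ∀ f x → csuc (shift f x) ≡ shift f (csuc x)
    csuc-shift false x = refl
    csuc-shift true  x = sym (iter-commute a csuc x)

    row-step : ∀ (j j′ : Fin b) → suc (toℕ j) ≡ toℕ j′ → toℕ c₂ ≢ toℕ j → suc (toℕ (c₂ ⊖ʳ j′)) ≡ toℕ (c₂ ⊖ʳ j)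
    row-step j j′ j+1≡j′ c₂≢j with toℕ j′ ≤? toℕ c₂
    ... | yes j′≤c₂ = begin
      suc (toℕ (c₂ ⊖ʳ j′))          ≡⟨ cong suc (toℕ-⊖ʳ-≤ j′≤c₂) ⟩
      suc (toℕ c₂ ∸ toℕ j′)         ≡⟨ +-∸-assoc 1 j′≤c₂ ⟨
      suc (toℕ c₂) ∸ toℕ j′         ≡⟨ cong (suc (toℕ c₂) ∸_) (sym j+1≡j′) ⟩
      toℕ c₂ ∸ toℕ j                ≡⟨ toℕ-⊖ʳ-≤ (≤-trans (n≤1+n (toℕ j)) (subst (_≤ toℕ c₂) (sym j+1≡j′) j′≤c₂)) ⟨
      toℕ (c₂ ⊖ʳ j)                 ∎
      where open ≡-Reasoning
    ... | no  j′≰c₂ = begin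
      suc (toℕ (c₂ ⊖ʳ j′))          ≡⟨ cong suc (toℕ-⊖ʳ-> (≰⇒> j′≰c₂)) ⟩
      suc (toℕ c₂ + b ∸ toℕ j′)     ≡⟨ +-∸-assoc 1 j′≤c₂+b ⟨
      suc (toℕ c₂ + b) ∸ toℕ j′     ≡⟨ cong (suc (toℕ c₂ + b) ∸_) (sym j+1≡j′) ⟩
      toℕ c₂ + b ∸ toℕ j            ≡⟨ toℕ-⊖ʳ-> c₂<j ⟨
      toℕ (c₂ ⊖ʳ j)                 ∎
      where
      open ≡-Reasoning
      j′≤c₂+b : toℕ j′ ≤ toℕ c₂ + b
      j′≤c₂+b = ≤-trans (<⇒≤ (toℕ<n j′)) (m≤n+m b (toℕ c₂))
      c₂<j : toℕ c₂ < toℕ j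
      c₂<j = ≤∧≢⇒< (≤-pred (subst (toℕ c₂ <_) (sym j+1≡j′) (≰⇒> j′≰c₂))) c₂≢j

    row-crossing : ∀ (j′ : Fin b) → suc (toℕ c₂) ≡ toℕ j′ → T (suc (toℕ (c₂ ⊖ʳ j′)) ≡ᵇ b)
    row-crossing j′ c₂+1≡j′ = ≡⇒≡ᵇ (suc (toℕ (c₂ ⊖ʳ j′))) b (begin
      suc (toℕ (c₂ ⊖ʳ j′))              ≡⟨ cong suc (toℕ-⊖ʳ-> (≤-reflexive c₂+1≡j′)) ⟩
      suc (toℕ c₂ + b ∸ toℕ j′)         ≡⟨ cong (λ t → suc (toℕ c₂ + b ∸ t)) (sym c₂+1≡j′) ⟩
      suc (toℕ c₂ + b ∸ suc (toℕ c₂))   ≡⟨ cong (λ t → suc (t ∸ suc (toℕ c₂))) (+-suc (toℕ c₂) (suc ⌈ h /2⌉)) ⟩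
      suc (toℕ c₂ + suc ⌈ h /2⌉ ∸ toℕ c₂) ≡⟨ cong suc (m+n∸m≡n (toℕ c₂) _) ⟩
      b                                 ∎)
      where open ≡-Reasoning

    toℕ-row-zero : toℕ (c₂ ⊖ʳ zero) ≡ toℕ c₂
    toℕ-row-zero = toℕ-⊖ʳ-≤ {c₂} {zero} z≤n

    row-jump : ∀ (w : Fin b) → T (suc (toℕ w) ≡ᵇ b) → toℕ c₂ < toℕ w → T (suc (toℕ (c₂ ⊖ʳ zero)) ≡ᵇ toℕ (c₂ ⊖ʳ w))
    row-jump w q c₂<w = ≡⇒≡ᵇ (suc (toℕ (c₂ ⊖ʳ zero))) (toℕ (c₂ ⊖ʳ w)) (begin
      suc (toℕ (c₂ ⊖ʳ zero))            ≡⟨ cong suc toℕ-row-zero ⟩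
      suc (toℕ c₂)                      ≡⟨ m+n∸n≡m (suc (toℕ c₂)) (toℕ w) ⟨
      suc (toℕ c₂) + toℕ w ∸ toℕ w      ≡⟨ cong (_∸ toℕ w) (sym (+-suc (toℕ c₂) (toℕ w))) ⟩
      toℕ c₂ + suc (toℕ w) ∸ toℕ w      ≡⟨ cong (λ t → toℕ c₂ + t ∸ toℕ w) (≡ᵇ⇒≡ (suc (toℕ w)) b q) ⟩
      toℕ c₂ + b ∸ toℕ w                ≡⟨ toℕ-⊖ʳ-> c₂<w ⟨
      toℕ (c₂ ⊖ʳ w)                     ∎)
      where open ≡-Reasoning

    image : ∀ e → EdgeImage {G = G} φ switch e
    image (vert i j j′ p) with toℕ c₂ ≟ toℕ j
    ... | no c₂≢j = record
      { edge  = vert x (c₂ ⊖ʳ j′) (c₂ ⊖ʳ j) (≡⇒≡ᵇ _ _ (row-step j j′ j+1≡j′ c₂≢j))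
      ; joins = inj₂ (cong (λ f → shift f (c₁ ⊖ i) , c₂ ⊖ʳ j′) (sym same-side) , refl)
      ; sign  = sym (begin
          false xor (above (c₂ ⊖ʳ j) xor above (c₂ ⊖ʳ j′)) ≡⟨ cong₂ (λ s t → s xor t) (above-⊖ʳ j) (above-⊖ʳ j′) ⟩
          above j xor above j′                              ≡⟨ cong (above j xor_) same-side ⟩
          above j xor above j                               ≡⟨ xor-same (above j) ⟩
          false                                             ∎) }
      where
      open ≡-Reasoning
      j+1≡j′ : suc (toℕ j) ≡ toℕ j′
      j+1≡j′ = ≡ᵇ⇒≡ (suc (toℕ j)) (toℕ j′) p
      x : Fin n
      x = shift (above j) (c₁ ⊖ i)
      same-side : above j′ ≡ above j
      same-side = trans (cong (λ t → does (toℕ c₂ <? t)) (sym j+1≡j′)) (<?-suc c₂≢j)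
    ... | yes c₂≡j = record
      { edge  = jump (c₁ ⊖ i) zero (c₂ ⊖ʳ j′) _ (row-crossing j′ c₂+1≡j′) _
      ; joins = inj₁ (cong₂ (λ f r → shift f (c₁ ⊖ i) , r) (sym (above-≤ (≤-reflexive (sym c₂≡j)))) (sym row-j≡zero) ,
                      cong (λ f → shift f (c₁ ⊖ i) , c₂ ⊖ʳ j′) (sym (above-> (≤-reflexive c₂+1≡j′))))
      ; sign  = cong₂ (λ s t → false xor (s xor t))
                  (sym (trans (above-⊖ʳ j) (above-≤ (≤-reflexive (sym c₂≡j)))))
                  (sym (trans (above-⊖ʳ j′) (above-> (≤-reflexive c₂+1≡j′)))) }
      where
      c₂+1≡j′ : suc (toℕ c₂) ≡ toℕ j′
      c₂+1≡j′ = trans (cong suc c₂≡j) (≡ᵇ⇒≡ (suc (toℕ j)) (toℕ j′) p)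
      row-j≡zero : c₂ ⊖ʳ j ≡ zero
      row-j≡zero = toℕ-injective (trans (cong (λ t → toℕ (c₂ ⊖ʳ t)) (toℕ-injective (sym c₂≡j))) (toℕ-⊖ʳ-self c₂))
    image (horiz i j _) = record
      { edge  = horiz (shift (above j) (c₁ ⊖ csuc i)) (c₂ ⊖ʳ j) _
      ; joins = inj₂ (refl , cong (_, c₂ ⊖ʳ j) (trans (csuc-shift (above j) (c₁ ⊖ csuc i))
                                                     (cong (shift (above j)) (addMod-⊖-addMod 1 c₁ i))))
      ; sign  = sym (xor-same (above (c₂ ⊖ʳ j))) }
    image (jump i zero w _ q _) with toℕ c₂ <? toℕ w
    ... | yes c₂<w = record
      { edge  = vert (c₁ ⊖ i) (c₂ ⊖ʳ zero) (c₂ ⊖ʳ w) (row-jump w q c₂<w)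
      ; joins = inj₁ (cong (λ f → shift f (c₁ ⊖ i) , c₂ ⊖ʳ zero) (sym above-zero) ,
                      cong (_, c₂ ⊖ʳ w) (sym (trans (cong (λ f → shift f (c₁ ⊖ addMod a i)) (above-> c₂<w))
                                                    (addMod-⊖-addMod a c₁ i))))
      ; sign  = cong₂ (λ s t → true xor (s xor t)) (sym (trans (above-⊖ʳ zero) above-zero))
                                                   (sym (trans (above-⊖ʳ w) (above-> c₂<w))) }
    ... | no  c₂≮w = record
      { edge  = jump (c₁ ⊖ addMod a i) zero c₂ _ (subst (λ t → T (suc (toℕ t) ≡ᵇ b)) w≡c₂ q) _
      ; joins = inj₂ (cong₂ (λ f r → shift f (c₁ ⊖ addMod a i) , r) (sym (above-≤ w≤c₂)) (sym row-w≡zero) ,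
                      cong₂ _,_ (trans (addMod-⊖-addMod a c₁ i) (cong (λ f → shift f (c₁ ⊖ i)) (sym above-zero)))
                                (toℕ-injective (sym toℕ-row-zero)))
      ; sign  = cong₂ (λ s t → true xor (s xor t)) (sym (trans (above-⊖ʳ zero) above-zero))
                                                   (sym (trans (above-⊖ʳ w) (above-≤ w≤c₂))) }
      where
      w≤c₂ : toℕ w ≤ toℕ c₂
      w≤c₂ = ≮⇒≥ c₂≮w
      w≡c₂ : w ≡ c₂
      w≡c₂ = toℕ-injective (≤-antisym w≤c₂ (≤-pred (subst (toℕ c₂ <_) (sym (≡ᵇ⇒≡ (suc (toℕ w)) b q)) (toℕ<n c₂))))
      row-w≡zero : c₂ ⊖ʳ w ≡ zero
      row-w≡zero = toℕ-injective (trans (cong (λ t → toℕ (c₂ ⊖ʳ t)) w≡c₂) (toℕ-⊖ʳ-self c₂))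

    involution : SwitchingInvolution G
    involution = switchingInvolution TT-noParallelEdges φ φ-involutive switch image

  o : VTT g
  o = zero , zero

  toBase : ToBase {G = G} o
  toBase (c₁ , c₂) = PointReflection.involution c₁ c₂ , PointReflection.φ-c c₁ c₂

  module ColumnReflection where

    φ : VTT g → VTT g
    φ (i , j) = zero ⊖ i , j

    φ-involutive : ∀ x → φ (φ x) ≡ x
    φ-involutive (i , j) = cong (_, j) (⊖-involutive zero i)

    φ-o : φ o ≡ o
    φ-o = cong (_, zero) (toℕ-injective (toℕ-⊖-self zero))

    half-turn-⊖ : ∀ i → addMod a (zero ⊖ i) ≡ zero ⊖ addMod a i
    half-turn-⊖ i = trans (cong (λ t → addMod a (zero ⊖ t)) (sym (addMod-half-involutive {a} (sym n≡a+a) i)))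
                          (addMod-⊖-addMod a zero (addMod a i))

    image : ∀ e → EdgeImage {G = G} φ (λ _ → false) e
    image (vert i j j′ p)    = record { edge = vert (zero ⊖ i) j j′ p ; joins = inj₁ (refl , refl) ; sign = refl }
    image (horiz i j _)      = record { edge = horiz (zero ⊖ csuc i) j _
                                      ; joins = inj₂ (refl , cong (_, j) (addMod-⊖-addMod 1 zero i)) ; sign = refl }
    image (jump i z w p q _) = record { edge = jump (zero ⊖ i) z w p q _
                                      ; joins = inj₁ (refl , cong (_, w) (half-turn-⊖ i)) ; sign = refl }

    involution : SwitchingInvolution G
    involution = switchingInvolution TT-noParallelEdges φ φ-involutive (λ _ → false) image

    toℕ-φ-≤ : ∀ (i : Fin n) → a < toℕ i → toℕ (zero ⊖ i) ≤ a
    toℕ-φ-≤ i a<i = begin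
      toℕ (zero ⊖ i)   ≡⟨ toℕ-⊖-> {zero} {i} (≤-<-trans z≤n a<i) ⟩
      n ∸ toℕ i        ≤⟨ ∸-monoʳ-≤ n (<⇒≤ a<i) ⟩
      n ∸ a            ≡⟨ cong (_∸ a) n≡a+a ⟩
      a + a ∸ a        ≡⟨ m+n∸n≡m a a ⟩
      a                ∎
      where open ≤-Reasoning

  κ : VTT g → ℕ
  κ (i , j) = toℕ i + toℕ j

  column : (x : Fin n) (j j′ : Fin b) (m : ℕ) → toℕ j + m ≡ toℕ j′ → Walk G (x , j) (x , j′)
  column x j j′ zero    eq with toℕ-injective (trans (sym (+-identityʳ (toℕ j))) eq)
  ... | refl = []
  column x j j′ (suc m) eq = step (vert x j (fromℕ< j+1<b) (≡⇒≡ᵇ _ _ (sym (toℕ-fromℕ< j+1<b)))) (inj₁ (refl , refl))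
                                  (column x (fromℕ< j+1<b) j′ m (trans (cong (_+ m) (toℕ-fromℕ< j+1<b)) (trans (sym (+-suc (toℕ j) m)) eq)))
    where
    j+1<b : suc (toℕ j) < b
    j+1<b = straight-step-< {j = j} {j′} eq

  len-column : ∀ x j j′ m eq → len (column x j j′ m eq) ≡ m
  len-column x j j′ zero    eq with toℕ-injective (trans (sym (+-identityʳ (toℕ j))) eq)
  ... | refl = refl
  len-column x j j′ (suc m) eq = cong suc (len-column x _ j′ m _)

  column-ascent : ∀ x j j′ m eq → PositiveAscent κ (column x j j′ m eq)
  column-ascent x j j′ zero    eq with toℕ-injective (trans (sym (+-identityʳ (toℕ j))) eq)
  ... | refl = tt
  column-ascent x j j′ (suc m) eq =
    trans (cong (toℕ x +_) (toℕ-fromℕ< (straight-step-< {j = j} {j′} eq))) (+-suc (toℕ x) (toℕ j)) , refl , column-ascent x _ j′ m _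

  row : (j : Fin b) (i i′ : Fin n) (m : ℕ) → toℕ i + m ≡ toℕ i′ → Walk G (i , j) (i′ , j)
  row j i i′ zero    eq with toℕ-injective (trans (sym (+-identityʳ (toℕ i))) eq)
  ... | refl = []
  row j i i′ (suc m) eq = step (horiz i j _) (inj₁ (refl , cong (_, j) (csuc-fromℕ< i i+1<n)))
                               (row j (fromℕ< i+1<n) i′ m (trans (cong (_+ m) (toℕ-fromℕ< i+1<n)) (trans (sym (+-suc (toℕ i) m)) eq)))
    where
    i+1<n : suc (toℕ i) < n
    i+1<n = straight-step-< {j = i} {i′} eq

  len-row : ∀ j i i′ m eq → len (row j i i′ m eq) ≡ m
  len-row j i i′ zero    eq with toℕ-injective (trans (sym (+-identityʳ (toℕ i))) eq)
  ... | refl = refl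
  len-row j i i′ (suc m) eq = cong suc (len-row j _ i′ m _)

  row-ascent : ∀ j i i′ m eq → PositiveAscent κ (row j i i′ m eq)
  row-ascent j i i′ zero    eq with toℕ-injective (trans (sym (+-identityʳ (toℕ i))) eq)
  ... | refl = tt
  row-ascent j i i′ (suc m) eq = cong (_+ toℕ j) (toℕ-fromℕ< (straight-step-< {j = i} {i′} eq)) , refl , row-ascent j _ i′ m _

  row-visits : ∀ j i i′ m eq (t : Fin n) → toℕ i ≤ toℕ t → toℕ t ≤ toℕ i′ → (t , j) ∈ visits (row j i i′ m eq)
  row-visits j i i′ zero    eq t i≤t t≤i′ with toℕ-injective (trans (sym (+-identityʳ (toℕ i))) eq)
  ... | refl = here (cong (_, j) (toℕ-injective (≤-antisym t≤i′ i≤t)))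
  row-visits j i i′ (suc m) eq t i≤t t≤i′ with toℕ i ≟ toℕ t
  ... | yes i≡t = here (cong (_, j) (toℕ-injective (sym i≡t)))
  ... | no  i≢t =
    there (row-visits j _ i′ m _ t (subst (_≤ toℕ t) (sym (toℕ-fromℕ< (straight-step-< {j = i} {i′} eq))) (≤∧≢⇒< i≤t i≢t)) t≤i′)

  half : Fin n
  half = addMod a zero

  toℕ-half : toℕ half ≡ a
  toℕ-half = toℕ-addMod-< zero (s≤s z≤n)

  j≤last : ∀ (j : Fin b) → toℕ j ≤ toℕ last
  j≤last j = subst (toℕ j ≤_) (sym toℕ-last) (≤-pred (toℕ<n j))

  module Cycle (j : Fin b) where

    climb₁ : Walk G o (zero , j)
    climb₁ = column zero zero j (toℕ j) refl

    across : Walk G (zero , j) (half , j)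
    across = row j zero half a (sym toℕ-half)

    climb₂ : Walk G (half , j) (half , last)
    climb₂ = column half j last (toℕ last ∸ toℕ j) (m+[n∸m]≡n (j≤last j))

    path : Walk G o (half , last)
    path = climb₁ ++ʷ across ++ʷ climb₂

    path-ascent : PositiveAscent κ path
    path-ascent = ++ʷ-ascent κ climb₁ (across ++ʷ climb₂) (column-ascent zero zero j (toℕ j) refl)
                    (++ʷ-ascent κ across climb₂ (row-ascent j zero half a (sym toℕ-half))
                                               (column-ascent half j last (toℕ last ∸ toℕ j) (m+[n∸m]≡n (j≤last j))))

    closing : Joins G (jump zero zero last _ last-isLast _) (half , last) o
    closing = inj₂ (refl , refl)

    cycle : Walk G o o
    cycle = path ++ʷ step (jump zero zero last _ last-isLast _) closing []

    len-path : len path ≡ toℕ j + (a + (toℕ last ∸ toℕ j))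
    len-path = begin
      len (climb₁ ++ʷ across ++ʷ climb₂)          ≡⟨ len-++ʷ climb₁ (across ++ʷ climb₂) ⟩
      len climb₁ + len (across ++ʷ climb₂)        ≡⟨ cong (len climb₁ +_) (len-++ʷ across climb₂) ⟩
      len climb₁ + (len across + len climb₂)      ≡⟨ cong₂ (λ x y → x + (y + len climb₂)) (len-column zero zero j (toℕ j) refl)
                                                                                         (len-row j zero half a (sym toℕ-half)) ⟩
      toℕ j + (a + len climb₂)                    ≡⟨ cong (λ t → toℕ j + (a + t)) (len-column half j last (toℕ last ∸ toℕ j) (m+[n∸m]≡n (j≤last j))) ⟩
      toℕ j + (a + (toℕ last ∸ toℕ j))            ∎
      where open ≡-Reasoning

    len-cycle : len cycle ≡ g
    len-cycle = begin
      len cycle                               ≡⟨ len-++ʷ path (step (jump zero zero last _ last-isLast _) closing []) ⟩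
      len path + 1                            ≡⟨ cong (_+ 1) len-path ⟩
      toℕ j + (a + (toℕ last ∸ toℕ j)) + 1    ≡⟨ cong (_+ 1) (sym (+-assoc (toℕ j) a (toℕ last ∸ toℕ j))) ⟩
      toℕ j + a + (toℕ last ∸ toℕ j) + 1      ≡⟨ cong (λ t → t + (toℕ last ∸ toℕ j) + 1) (+-comm (toℕ j) a) ⟩
      a + toℕ j + (toℕ last ∸ toℕ j) + 1      ≡⟨ cong (_+ 1) (+-assoc a (toℕ j) (toℕ last ∸ toℕ j)) ⟩
      a + (toℕ j + (toℕ last ∸ toℕ j)) + 1    ≡⟨ cong (λ t → a + t + 1) (m+[n∸m]≡n (j≤last j)) ⟩
      a + toℕ last + 1                        ≡⟨ +-assoc a (toℕ last) 1 ⟩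
      a + (toℕ last + 1)                      ≡⟨ cong (a +_) (trans (+-comm (toℕ last) 1) (cong suc toℕ-last)) ⟩
      a + b                                   ≡⟨ a+b≡g ⟩
      g                                       ∎
      where open ≡-Reasoning

    visits-row : ∀ (i : Fin n) → toℕ i ≤ a → (i , j) ∈ verts cycle
    visits-row i i≤a =
      subst ((i , j) ∈_) (sym (verts-++ʷ path (step (jump zero zero last _ last-isLast _) closing [])))
        (∈-visits-++ʷʳ climb₁ (across ++ʷ climb₂)
          (∈-visits-++ʷˡ across climb₂ (row-visits j zero half a (sym toℕ-half) i z≤n (subst (toℕ i ≤_) (sym toℕ-half) i≤a))))

    o∈cycle : o ∈ verts cycle
    o∈cycle = subst (o ∈_) (sym (verts-++ʷ path (step (jump zero zero last _ last-isLast _) closing []))) (start∈visits path)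

    negCycle : ∀ (i : Fin n) → toℕ i ≤ a → NegCycleThrough g G o (i , j)
    negCycle i i≤a =
      o , cycle , ascent-closing-isCycle κ path path-ascent refl closing , len-cycle ,
      ascent-closing-sgn κ path path-ascent refl closing , o∈cycle , visits-row i i≤a

  negCycle : ∀ w → NegCycleThrough g G o w
  negCycle (i , j) with toℕ i ≤? a
  ... | yes i≤a = Cycle.negCycle j i i≤a
  ... | no  i≰a = subst₂ (NegCycleThrough g G) φ-o (φ-involutive (i , j))
                    (SwitchingInvolution.mapʷ-negCycle involution (Cycle.negCycle j (zero ⊖ i) (toℕ-φ-≤ i (≰⇒> i≰a))))
    where open ColumnReflection

TT-involutionsToBase : ∀ g → 2 ≤ g →
  Σ (VTT g) λ o → ToBase {G = TTJ g} o × (∀ w → NegCycleThrough g (TTJ g) o w)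
TT-involutionsToBase 0 ()
TT-involutionsToBase 1 (s≤s ())
TT-involutionsToBase 2 _ = TT2.o , TT2.toBase , TT2.cycle
TT-involutionsToBase 3 _ = TT3.o , TT3.toBase , TT3.cycle
TT-involutionsToBase (suc (suc (suc (suc h)))) _ = TTLarge.o h , TTLarge.toBase h , TTLarge.negCycle h

lemma5 : (g : ℕ) → 2 ≤ g →
    SubgraphOfSPC (TTJ g) (g ∸ 1)
    × VertexTransitive (TTJ g)
    × NegCyclesThroughPairs g (TTJ g)
    × Wide g (TTJ g)
lemma5 0 ()
lemma5 1 (s≤s ())
lemma5 (suc (suc h)) 2≤g = embedding , proj₁ symmetric , proj₂ symmetric , SPC⇒wide embedding
  where
  embedding : SubgraphOfSPC (TTJ (suc (suc h))) (suc h)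
  embedding = TTEmbedding.TT-subgraphOfSPC h
  symmetric : VertexTransitive (TTJ (suc (suc h))) × NegCyclesThroughPairs (suc (suc h)) (TTJ (suc (suc h)))
  symmetric = involutionsToBase⇒symmetric (TT-involutionsToBase (suc (suc h)) 2≤g)
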